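{- Let $S$ be a nonempty admissible finite set of positive integers and $m=\max S$. Then $$\sum_{n\ge1}\#P(S;n)\,x^n=\frac{r(x)}{(1-2x)^m},\qquad\text{where}\qquad r(x)=(1-2x)^m\sum_{n\ge1}\#P(S;n)x^n=\sum_{k=m+1}^{2m-1}x^k\sum_{j=0}^{k-m-1}(-2)^j\binom{m}{j}\#P(S;k-j)$$ is a polynomial. Furthermore, for all $n\ge 2m$, $$\sum_{j=0}^{m}(-2)^j\binom{m}{j}\#P(S;n-j)=0.$$
   Context: For a permutation $\pi=a_1\ldots a_n$ of $\{1,\ldots,n\}$, an index $i$ is a peak if $a_{i-1}<a_i>a_{i+1}$, and $P(\pi)$ is the set of peaks. $P(S;n)$ is the set of permutations of $\{1,\dots,n\}$ with peak set exactly $S$. A finite set $S$ (not depending on $n$) is admissible if $\#P(S;n)\neq0$ for some $n$. -}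

module Defs where

open import Data.Bool using (Bool; T?; true; false; _∧_; not; if_then_else_)
open import Data.Nat using (ℕ; zero; suc; _+_; _∸_; _≤ᵇ_; _<ᵇ_; _≡ᵇ_; _⊔_)
open import Data.List using (List; []; _∷_; map; concatMap; upTo; filter; length; foldr; all; any)
open import Data.Integer as ℤ using (ℤ)
open import Data.Nat.Combinatorics using (_C_)
open import Relation.Binary.PropositionalEquality using (_≡_)
open import Relation.Nullary using (¬_)
open import Data.Product using (∃)

-- Permutations of {1,…,n}, represented as lists a₁…aₙ.

words : ℕ → List ℕ → List (List ℕ)
words zero    A = [] ∷ []
words (suc k) A = concatMap (λ a → map (a ∷_) (words k A)) A

range : ℕ → List ℕ
range n = map suc (upTo n)

elem : ℕ → List ℕ → Bool
elem x xs = any (λ y → x ≡ᵇ y) xs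

distinct : List ℕ → Bool
distinct []       = true
distinct (x ∷ xs) = not (elem x xs) ∧ distinct xs

perms : ℕ → List (List ℕ)
perms n = filter (λ w → T? (distinct w)) (words n (range n))

-- Peaks (1-indexed: a_i is entry i)

at : List ℕ → ℕ → ℕ   -- at π i = a_i  (i ≥ 1); junk 0 outside range
at []       _             = 0
at (x ∷ xs) zero          = 0
at (x ∷ xs) (suc zero)    = x
at (x ∷ xs) (suc (suc i)) = at xs (suc i)

isPeak : List ℕ → ℕ → Bool
isPeak π i = (2 ≤ᵇ i) ∧ (i <ᵇ length π)
           ∧ (at π (i ∸ 1) <ᵇ at π i) ∧ (at π (i + 1) <ᵇ at π i)

beq : Bool → Bool → Bool
beq true  b = b
beq false b = not b

hasPeakSet : List ℕ → List ℕ → Bool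
hasPeakSet S π = all (λ i → beq (isPeak π i) (elem i S)) (range (length π))
               ∧ all (isPeak π) S

countP : List ℕ → ℕ → ℕ
countP S n = length (filter (λ π → T? (hasPeakSet S π)) (perms n))

Admissible : List ℕ → Set
Admissible S = ∃ λ n → ¬ (countP S n ≡ 0)

maxL : List ℕ → ℕ
maxL = foldr _⊔_ 0

Series : Set
Series = ℕ → ℤ

sumTo : ℕ → (ℕ → ℤ) → ℤ
sumTo zero    f = f 0
sumTo (suc n) f = sumTo n f ℤ.+ f (suc n)

_⋆_ : Series → Series → Series
(a ⋆ b) n = sumTo n (λ i → a i ℤ.* b (n ∸ i))

oneS : Series
oneS zero    = ℤ.1ℤ
oneS (suc _) = ℤ.0ℤ

oneMinus2x : Series
oneMinus2x zero          = ℤ.1ℤ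
oneMinus2x (suc zero)    = ℤ.- (ℤ.+ 2)
oneMinus2x (suc (suc _)) = ℤ.0ℤ

powS : Series → ℕ → Series
powS a zero    = oneS
powS a (suc k) = a ⋆ powS a k

genP : List ℕ → Series
genP S zero    = ℤ.0ℤ
genP S (suc n) = ℤ.+ (countP S (suc n))

rPoly : List ℕ → Series
rPoly S k =
  if (suc m ≤ᵇ k) ∧ (k <ᵇ 2 Data.Nat.* m)
  then sumTo (k ∸ m ∸ 1) (λ j → (ℤ.- (ℤ.+ 2)) ℤ.^ j ℤ.* ℤ.+ (m C j) ℤ.* ℤ.+ countP S (k ∸ j))
  else ℤ.0ℤ
  where m = maxL S

module Submission where

-- The sequence a(n) = #P(S;n) satisfies the linear recurrence with characteristic
-- polynomial (1 - 2x)^m, m = max S, from n = 2m on; multiplying the generating function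
-- by (1 - 2x)^m therefore leaves only the polynomial r(x) of degree < 2m.
--
-- The proof follows Billey, Burdzy and Sagan.  Write E for the shift f(n) ↦ f(n-1) and
-- say that f is annihilated at order k (from k on) if ((1 - 2E)^k f)(n) = 0 for n ≥ 2k.
--   * Combinatorics: if m-1 ∉ S (otherwise S has two consecutive elements and all counts
--     vanish), splitting a permutation of [n] after position p = m-1 into a prefix with
--     peak set S₁ = S \ {m} and a peakless suffix gives
--        C(n,p) #P(S₁;p) 2^(n-p-1) = #P(S₁;n) + #P(S₁ ∪ {p};n) + #P(S;n),
--     using that there are 2^(k-1) peakless permutations of [k].
--   * Recurrence: n ↦ C(n,p) 2^n is annihilated by (1 - 2E)^(p+1); by strong induction on
--     max S (the sets S₁ and S₁ ∪ {p} have smaller maximum) #P(S;·) is annihilated at order m.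
--   * The generating-function identity is the coefficientwise form of this annihilation,
--     together with #P(S;n) = 0 for n ≤ m.

open import Defs

module Combinatorics where

  open import Data.Bool using (Bool; true; false; _∧_; _∨_; not; T; T?; if_then_else_)
  open import Data.Bool.Properties using (∧-assoc; ∧-comm; ∧-zeroʳ; ∧-identityʳ; ∨-assoc; ∨-zeroʳ; not-involutive)
  open import Data.Nat using (ℕ; zero; suc; _+_; _*_; _∸_; _≤_; _<_; z≤n; s≤s; z<s; _≤ᵇ_; _<ᵇ_; _≡ᵇ_; _^_)
  open import Data.Nat.Properties
  open import Data.Nat.Combinatorics using (_C_; nCk+nC[k+1]≡[n+1]C[k+1]; nCn≡1)
  open import Data.List using (List; []; _∷_; map; concatMap; length; filter; _++_; take; drop; all; applyUpTo; upTo)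
  open import Data.List.Properties using (length-map; length-++; length-take; take++drop≡id; take-map; drop-map; map-upTo; length-upTo)
  open import Data.List.Membership.Propositional using (_∈_)
  open import Data.List.Membership.Propositional.Properties using (∈-++⁺ˡ; ∈-++⁺ʳ; ∈-∃++)
  open import Data.List.Relation.Unary.Any using (here; there)
  open import Data.List.Relation.Unary.All using (All; []; _∷_; lookup) renaming (map to All-map)
  open import Relation.Binary.PropositionalEquality
  open import Relation.Binary using (tri<; tri≈; tri>)
  open import Data.Product using (_×_; _,_; proj₁; proj₂; ∃)
  open import Data.Sum using (_⊎_; inj₁; inj₂)
  open import Data.Empty using (⊥; ⊥-elim)
  open import Data.Unit using (tt)
  open import Relation.Nullary using (¬_; yes; no)
  open import Algebra.Properties.CommutativeSemigroup +-commutativeSemigroup using (interchange)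

  true≢false : true ≡ false → ⊥
  true≢false ()

  false≢true : false ≡ true → ⊥
  false≢true ()

  T→≡ : ∀ {b} → T b → b ≡ true
  T→≡ {true} _ = refl

  ≡→T : ∀ {b} → b ≡ true → T b
  ≡→T refl = tt

  ≢true⇒false : ∀ {b} → (b ≡ true → ⊥) → b ≡ false
  ≢true⇒false {true} h = ⊥-elim (h refl)
  ≢true⇒false {false} h = refl

  ⇔⇒≡ : ∀ {a b} → (a ≡ true → b ≡ true) → (b ≡ true → a ≡ true) → a ≡ b
  ⇔⇒≡ {true} f g = sym (f refl)
  ⇔⇒≡ {false} f g = sym (≢true⇒false (λ e → false≢true (g e)))

  ∨-true : ∀ {a b} → a ∨ b ≡ true → (a ≡ true) ⊎ (b ≡ true)
  ∨-true {true} _ = inj₁ refl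
  ∨-true {false} e = inj₂ e

  ∧-true-l : ∀ {a b} → a ∧ b ≡ true → a ≡ true
  ∧-true-l {true} _ = refl

  ∧-true-r : ∀ {a b} → a ∧ b ≡ true → b ≡ true
  ∧-true-r {true} e = e

  <ᵇ-true : ∀ {m n} → m < n → (m <ᵇ n) ≡ true
  <ᵇ-true p = T→≡ (<⇒<ᵇ p)

  <ᵇ-false : ∀ {m n} → ¬ m < n → (m <ᵇ n) ≡ false
  <ᵇ-false {m} {n} p with m <ᵇ n in eq
  ... | true = ⊥-elim (p (<ᵇ⇒< m n (≡→T eq)))
  ... | false = refl

  <ᵇ-sound : ∀ m n → (m <ᵇ n) ≡ true → m < n
  <ᵇ-sound m n e = <ᵇ⇒< m n (≡→T e)

  <ᵇ-sound-false : ∀ m n → (m <ᵇ n) ≡ false → ¬ m < n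
  <ᵇ-sound-false m n e p = true≢false (trans (sym (<ᵇ-true p)) e)

  ≡ᵇ-true : ∀ {m n} → m ≡ n → (m ≡ᵇ n) ≡ true
  ≡ᵇ-true {m} refl = T→≡ (≡⇒≡ᵇ m m refl)

  ≡ᵇ-false : ∀ {m n} → m ≢ n → (m ≡ᵇ n) ≡ false
  ≡ᵇ-false {m} {n} p with m ≡ᵇ n in eq
  ... | true = ⊥-elim (p (≡ᵇ⇒≡ m n (≡→T eq)))
  ... | false = refl

  ≡ᵇ-sound : ∀ {m n} → (m ≡ᵇ n) ≡ true → m ≡ n
  ≡ᵇ-sound {m} {n} e = ≡ᵇ⇒≡ m n (≡→T e)

  ≡ᵇ-comm : ∀ x y → (x ≡ᵇ y) ≡ (y ≡ᵇ x)
  ≡ᵇ-comm zero zero = refl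
  ≡ᵇ-comm zero (suc y) = refl
  ≡ᵇ-comm (suc x) zero = refl
  ≡ᵇ-comm (suc x) (suc y) = ≡ᵇ-comm x y

  ≤ᵇ-true : ∀ {m n} → m ≤ n → (m ≤ᵇ n) ≡ true
  ≤ᵇ-true p = T→≡ (≤⇒≤ᵇ p)

  ≤ᵇ-sound : ∀ {m n} → (m ≤ᵇ n) ≡ true → m ≤ n
  ≤ᵇ-sound {m} {n} e = ≤ᵇ⇒≤ m n (≡→T e)

  χ : Bool → ℕ
  χ true = 1
  χ false = 0

  sumOver : {A : Set} → List A → (A → ℕ) → ℕ
  sumOver [] f = 0
  sumOver (x ∷ xs) f = f x + sumOver xs f

  sumOver-cong : {A : Set} (L : List A) {f g : A → ℕ} → (∀ a → f a ≡ g a) → sumOver L f ≡ sumOver L g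
  sumOver-cong [] e = refl
  sumOver-cong (x ∷ L) e = cong₂ _+_ (e x) (sumOver-cong L e)

  sumOver-cong∈ : {A : Set} (L : List A) {f g : A → ℕ} → (∀ {a} → a ∈ L → f a ≡ g a) → sumOver L f ≡ sumOver L g
  sumOver-cong∈ [] e = refl
  sumOver-cong∈ (x ∷ L) e = cong₂ _+_ (e (here refl)) (sumOver-cong∈ L (λ m → e (there m)))

  sumOver-0 : {A : Set} (L : List A) → sumOver L (λ _ → 0) ≡ 0
  sumOver-0 [] = refl
  sumOver-0 (x ∷ L) = sumOver-0 L

  sumOver-+ : {A : Set} (L : List A) (f h : A → ℕ) → sumOver L (λ a → f a + h a) ≡ sumOver L f + sumOver L h
  sumOver-+ [] f h = refl
  sumOver-+ (x ∷ L) f h = trans (cong (f x + h x +_) (sumOver-+ L f h))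
      (interchange (f x) (h x) (sumOver L f) (sumOver L h))

  sumOver-* : {A : Set} (L : List A) (f : A → ℕ) (c : ℕ) → sumOver L (λ a → f a * c) ≡ sumOver L f * c
  sumOver-* [] f c = refl
  sumOver-* (x ∷ L) f c = trans (cong (f x * c +_) (sumOver-* L f c)) (sym (*-distribʳ-+ c (f x) (sumOver L f)))

  sumOver-const : {A : Set} (L : List A) (c : ℕ) → sumOver L (λ _ → c) ≡ length L * c
  sumOver-const [] c = refl
  sumOver-const (x ∷ L) c = cong (c +_) (sumOver-const L c)

  sumOver-++ : {A : Set} (xs ys : List A) (f : A → ℕ) → sumOver (xs ++ ys) f ≡ sumOver xs f + sumOver ys f
  sumOver-++ [] ys f = refl
  sumOver-++ (x ∷ xs) ys f = trans (cong (f x +_) (sumOver-++ xs ys f)) (sym (+-assoc (f x) _ _))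

  sumOver-concatMap : {A C : Set} (h : C → ℕ) (f : A → List C) (L : List A)
      → sumOver (concatMap f L) h ≡ sumOver L (λ a → sumOver (f a) h)
  sumOver-concatMap h f [] = refl
  sumOver-concatMap h f (x ∷ L) = trans (sumOver-++ (f x) (concatMap f L) h)
      (cong (sumOver (f x) h +_) (sumOver-concatMap h f L))

  sumOver-map : {A C : Set} (h : C → ℕ) (g : A → C) (L : List A) → sumOver (map g L) h ≡ sumOver L (λ x → h (g x))
  sumOver-map h g [] = refl
  sumOver-map h g (x ∷ L) = cong (h (g x) +_) (sumOver-map h g L)

  filterᵇ : {A : Set} → (A → Bool) → List A → List A
  filterᵇ p [] = []
  filterᵇ p (x ∷ xs) = if p x then x ∷ filterᵇ p xs else filterᵇ p xs

  sumOver-filterᵇ : {A : Set} (q : A → Bool) (L : List A) (f : A → ℕ)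
      → sumOver (filterᵇ q L) f ≡ sumOver L (λ b → if q b then f b else 0)
  sumOver-filterᵇ q [] f = refl
  sumOver-filterᵇ q (x ∷ L) f with q x
  ... | true = cong (f x +_) (sumOver-filterᵇ q L f)
  ... | false = sumOver-filterᵇ q L f

  count : {A : Set} → (A → Bool) → List A → ℕ
  count p L = sumOver L (λ x → χ (p x))

  count-cong : {A : Set} (L : List A) {p q : A → Bool} → (∀ a → p a ≡ q a) → count p L ≡ count q L
  count-cong L e = sumOver-cong L (λ a → cong χ (e a))

  count-cong∈ : {A : Set} (L : List A) {p q : A → Bool} → (∀ {a} → a ∈ L → p a ≡ q a) → count p L ≡ count q L
  count-cong∈ L e = sumOver-cong∈ L (λ a∈ → cong χ (e a∈))

  count-false : {A : Set} (L : List A) → count (λ _ → false) L ≡ 0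
  count-false L = sumOver-0 L

  count-∨ : {A : Set} (L : List A) (p q : A → Bool) → (∀ x → p x ∧ q x ≡ false)
      → count (λ x → p x ∨ q x) L ≡ count p L + count q L
  count-∨ [] p q d = refl
  count-∨ (x ∷ L) p q d with p x in ep | q x in eq
  ... | true | true = ⊥-elim (true≢false (trans (sym (cong₂ _∧_ ep eq)) (d x)))
  ... | true | false = cong suc (count-∨ L p q d)
  ... | false | true = trans (cong suc (count-∨ L p q d)) (sym (+-suc (count p L) (count q L)))
  ... | false | false = count-∨ L p q d

  count-not : {A : Set} (L : List A) (q : A → Bool) → count (λ x → not (q x)) L + count q L ≡ length L
  count-not [] q = refl
  count-not (x ∷ L) q with q x
  ... | true = trans (+-suc (count (λ x → not (q x)) L) (count q L)) (cong suc (count-not L q))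
  ... | false = cong suc (count-not L q)

  count≡0⇒false : {A : Set} (q : A → Bool) (L : List A) → count q L ≡ 0 → ∀ {x} → x ∈ L → q x ≡ false
  count≡0⇒false q (y ∷ L) e (here refl) with q y
  ... | false = refl
  count≡0⇒false q (y ∷ L) e (there m) with q y
  ... | false = count≡0⇒false q L e m

  sumOver-single : ∀ {y} (L : List ℕ) (f : ℕ → ℕ) → count (λ x → x ≡ᵇ y) L ≡ 1
      → (∀ a → a ≢ y → f a ≡ 0) → sumOver L f ≡ f y
  sumOver-single {y} (x ∷ L) f c h with x ≡ᵇ y in e
  ... | true rewrite ≡ᵇ-sound {x} {y} e = trans (cong (f y +_) (trans (sumOver-cong∈ L (λ {a} a∈ → h a (λ a≡y → false≢true (trans (sym (count≡0⇒false (λ x → x ≡ᵇ y) L (suc-injective c) a∈)) (≡ᵇ-true a≡y))))) (sumOver-0 L))) (+-identityʳ (f y))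
  ... | false = trans
      (cong (_+ sumOver L f) (h x (λ x≡y → true≢false (trans (sym (≡ᵇ-true x≡y)) e))))
      (sumOver-single L f c h)

  sumOver-swap : {A C : Set} (L1 : List A) (L2 : List C) (P : A → C → Bool) →
    sumOver L1 (λ x → count (P x) L2) ≡ sumOver L2 (λ y → count (λ x → P x y) L1)
  sumOver-swap L1 [] P = sumOver-0 L1
  sumOver-swap L1 (y ∷ L2) P = trans (sumOver-+ L1 (λ x → χ (P x y)) (λ x → count (P x) L2))
      (cong (count (λ x → P x y) L1 +_) (sumOver-swap L1 L2 P))

  length-filter≡count : {A : Set} (q : A → Bool) (L : List A) → length (filter (λ x → T? (q x)) L) ≡ count q L
  length-filter≡count q [] = refl
  length-filter≡count q (x ∷ L) with q x
  ... | true = cong suc (length-filter≡count q L)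
  ... | false = length-filter≡count q L

  count-filter : {A : Set} (q p : A → Bool) (L : List A)
      → count p (filter (λ x → T? (q x)) L) ≡ count (λ x → q x ∧ p x) L
  count-filter q p [] = refl
  count-filter q p (x ∷ L) with q x
  ... | true = cong (χ (p x) +_) (count-filter q p L)
  ... | false = count-filter q p L

  IsWord : ℕ → List ℕ → List ℕ → Set
  IsWord k A w = (length w ≡ k) × All (λ x → x ∈ A) w

  sumOver-words-suc : (h : List ℕ → ℕ) (k : ℕ) (A : List ℕ)
      → sumOver (words (suc k) A) h ≡ sumOver A (λ a → sumOver (words k A) (λ w → h (a ∷ w)))
  sumOver-words-suc h k A = trans (sumOver-concatMap h (λ a → map (a ∷_) (words k A)) A)
      (sumOver-cong A (λ a → sumOver-map h (a ∷_) (words k A)))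

  sumOver-cong-words : (k : ℕ) (A : List ℕ) {f h : List ℕ → ℕ} → (∀ w → IsWord k A w → f w ≡ h w)
      → sumOver (words k A) f ≡ sumOver (words k A) h
  sumOver-cong-words zero A e = cong (_+ 0) (e [] (refl , []))
  sumOver-cong-words (suc k) A {f} {h} e =
    trans (sumOver-words-suc f k A)
        (trans (sumOver-cong∈ A (λ {a} a∈ → sumOver-cong-words k A (λ w wi → e (a ∷ w) (cong suc (proj₁ wi) , (a∈ ∷ proj₂ wi))))) (sym (sumOver-words-suc h k A)))

  count-words-suc : (p : List ℕ → Bool) (k : ℕ) (A : List ℕ)
      → count p (words (suc k) A) ≡ sumOver A (λ a → count (λ w → p (a ∷ w)) (words k A))
  count-words-suc p k A = sumOver-words-suc (λ w → χ (p w)) k A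

  count-cong-words : (k : ℕ) (A : List ℕ) {p q : List ℕ → Bool} → (∀ w → IsWord k A w → p w ≡ q w)
      → count p (words k A) ≡ count q (words k A)
  count-cong-words k A e = sumOver-cong-words k A (λ w wi → cong χ (e w wi))

  count-words-snoc : (R : List ℕ → Bool) (k : ℕ) (A : List ℕ)
      → count R (words (suc k) A) ≡ sumOver (words k A) (λ u → count (λ c → R (u ++ c ∷ [])) A)
  count-words-snoc R zero A = trans (count-words-suc R 0 A)
      (trans (sumOver-cong A (λ a → +-identityʳ (χ (R (a ∷ []))))) (sym (+-identityʳ _)))
  count-words-snoc R (suc k) A =
    trans (count-words-suc R (suc k) A)
    (trans (sumOver-cong A (λ a → count-words-snoc (λ w → R (a ∷ w)) k A))
    (sym (sumOver-words-suc (λ u → count (λ c → R (u ++ c ∷ [])) A) k A)))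

  interval : ℕ → ℕ → List ℕ
  interval s zero = []
  interval s (suc n) = s ∷ interval (suc s) n

  applyUpTo-cong : ∀ {f g : ℕ → ℕ} n → (∀ i → f i ≡ g i) → applyUpTo f n ≡ applyUpTo g n
  applyUpTo-cong zero e = refl
  applyUpTo-cong (suc n) e = cong₂ _∷_ (e 0) (applyUpTo-cong n (λ i → e (suc i)))

  applyUpTo≡interval : ∀ s n → applyUpTo (λ i → s + i) n ≡ interval s n
  applyUpTo≡interval s zero = refl
  applyUpTo≡interval s (suc n) = cong₂ _∷_ (+-identityʳ s)
      (trans (applyUpTo-cong n (λ i → +-suc s i)) (applyUpTo≡interval (suc s) n))

  range≡interval : ∀ n → range n ≡ interval 1 n
  range≡interval n = trans (map-upTo suc n) (applyUpTo≡interval 1 n)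

  length-range : ∀ n → length (range n) ≡ n
  length-range n = trans (length-map suc (upTo n)) (length-upTo n)

  ∈-interval⁻ : ∀ {x} s n → x ∈ interval s n → (s ≤ x) × (x < s + n)
  ∈-interval⁻ s (suc n) (here refl) = ≤-refl , m<m+n s z<s
  ∈-interval⁻ {x} s (suc n) (there m) with ∈-interval⁻ (suc s) n m
  ... | a , b = <⇒≤ a , subst (x <_) (sym (+-suc s n)) b

  ∈-interval⁺ : ∀ {x} s n → s ≤ x → x < s + n → x ∈ interval s n
  ∈-interval⁺ {x} s zero s≤x x< = ⊥-elim (<-irrefl refl (≤-trans x< (≤-trans (≤-reflexive (+-identityʳ s)) s≤x)))
  ∈-interval⁺ {x} s (suc n) s≤x x< with s ≟ x
  ... | yes refl = here refl
  ... | no s≢x = there (∈-interval⁺ (suc s) n (≤∧≢⇒< s≤x s≢x) (subst (x <_) (+-suc s n) x<))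

  ∈-range⁻ : ∀ {x} n → x ∈ range n → (1 ≤ x) × (x ≤ n)
  ∈-range⁻ {x} n m with ∈-interval⁻ 1 n (subst (x ∈_) (range≡interval n) m)
  ... | a , s≤s b = a , b

  ∈-range⁺ : ∀ {x} n → 1 ≤ x → x ≤ n → x ∈ range n
  ∈-range⁺ {x} n a b = subst (x ∈_) (sym (range≡interval n)) (∈-interval⁺ 1 n a (s≤s b))

  count-≡ᵇ-interval : ∀ {y} s n → s ≤ y → y < s + n → count (λ x → x ≡ᵇ y) (interval s n) ≡ 1
  count-≡ᵇ-interval {y} s zero s≤y y< = ⊥-elim (<-irrefl refl (≤-trans y< (≤-trans (≤-reflexive (+-identityʳ s)) s≤y)))
  count-≡ᵇ-interval {y} s (suc n) s≤y y< with s ≡ᵇ y in e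
  ... | true = cong suc
      (trans (count-cong∈ (interval (suc s) n) (λ {x} x∈ → ≡ᵇ-false (λ x≡y → <-irrefl (trans (≡ᵇ-sound e) (sym x≡y)) (proj₁ (∈-interval⁻ (suc s) n x∈))))) (count-false (interval (suc s) n)))
  ... | false = count-≡ᵇ-interval (suc s) n
      (≤∧≢⇒< s≤y (λ s≡y → true≢false (trans (sym (≡ᵇ-true s≡y)) e))) (subst (y <_) (+-suc s n) y<)

  count-max : ∀ n → 1 ≤ n → count (λ x → x ≡ᵇ n) (range n) ≡ 1
  count-max n h = trans (cong (count (λ x → x ≡ᵇ n)) (range≡interval n)) (count-≡ᵇ-interval 1 n h (s≤s ≤-refl))

  elem⇒∈ : ∀ i S → elem i S ≡ true → i ∈ S
  elem⇒∈ i (x ∷ S) e with ∨-true {i ≡ᵇ x} e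
  ... | inj₁ h = here (≡ᵇ-sound {i} {x} h)
  ... | inj₂ h = there (elem⇒∈ i S h)

  ∈⇒elem : ∀ {i} S → i ∈ S → elem i S ≡ true
  ∈⇒elem {i} (x ∷ S) (here refl) rewrite ≡ᵇ-true {i} {i} refl = refl
  ∈⇒elem {i} (x ∷ S) (there m) rewrite ∈⇒elem S m = ∨-zeroʳ (i ≡ᵇ x)

  ∉⇒≢ : ∀ {n x L} → elem n L ≡ false → x ∈ L → x ≢ n
  ∉⇒≢ {n} {x} {L} e m refl = false≢true (trans (sym e) (∈⇒elem L m))

  all⇒∈ : ∀ (p : ℕ → Bool) L {x} → all p L ≡ true → x ∈ L → p x ≡ true
  all⇒∈ p (y ∷ L) e (here refl) = ∧-true-l e
  all⇒∈ p (y ∷ L) e (there m) = all⇒∈ p L (∧-true-r {p y} e) m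

  ∈⇒all : ∀ (p : ℕ → Bool) L → (∀ {x} → x ∈ L → p x ≡ true) → all p L ≡ true
  ∈⇒all p [] h = refl
  ∈⇒all p (y ∷ L) h rewrite h (here refl) = ∈⇒all p L (λ m → h (there m))

  elem-++ : ∀ x xs ys → elem x (xs ++ ys) ≡ elem x xs ∨ elem x ys
  elem-++ x [] ys = refl
  elem-++ x (a ∷ xs) ys = trans (cong ((x ≡ᵇ a) ∨_) (elem-++ x xs ys)) (sym (∨-assoc (x ≡ᵇ a) (elem x xs) (elem x ys)))

  distinct-snoc-bool : ∀ A E X D → not (A ∨ (E ∨ false)) ∧ (not X ∧ D) ≡ not (E ∨ X) ∧ (not A ∧ D)
  distinct-snoc-bool true E X D = sym (∧-zeroʳ (not (E ∨ X)))
  distinct-snoc-bool false true X D = refl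
  distinct-snoc-bool false false true D = refl
  distinct-snoc-bool false false false D = refl

  distinct-snoc : ∀ u x → distinct (u ++ x ∷ []) ≡ not (elem x u) ∧ distinct u
  distinct-snoc [] x = refl
  distinct-snoc (a ∷ u) x =
    trans (cong₂ (λ p q → not p ∧ q) (elem-++ a u (x ∷ [])) (distinct-snoc u x))
    (trans (distinct-snoc-bool (elem a u) (a ≡ᵇ x) (elem x u) (distinct u))
    (cong (λ z → not (z ∨ elem x u) ∧ (not (elem a u) ∧ distinct u)) (≡ᵇ-comm a x)))

  distinct-around : ∀ pre x post → distinct (pre ++ x ∷ post) ≡ true → (elem x pre ≡ false) × (elem x post ≡ false)
  distinct-around [] x post d with elem x post
  ... | false = refl , refl
  ... | true = ⊥-elim (false≢true d)
  distinct-around (a ∷ pre) x post d with distinct-around pre x post (∧-true-r {not (elem a (pre ++ x ∷ post))} d)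
  ... | e1 , e2 = trans
      (cong (_∨ elem x pre) (≢true⇒false λ xa → false≢true (trans (sym (not-t (∧-true-l d))) (∈⇒elem (pre ++ x ∷ post) (subst (_∈ pre ++ x ∷ post) (≡ᵇ-sound {x} {a} xa) (∈-++⁺ʳ pre (here refl))))))) e1 , e2
    where
    not-t : ∀ {b} → not b ≡ true → b ≡ false
    not-t {false} _ = refl

  count-elem : ∀ n (u : List ℕ) → distinct u ≡ true → All (λ x → x ∈ range n) u
      → count (λ x → elem x u) (range n) ≡ length u
  count-elem n [] _ _ = count-false (range n)
  count-elem n (y ∷ u) du (y∈ ∷ a) with elem y u in ey
  ... | true = ⊥-elim (false≢true du)
  ... | false = trans (count-∨ (range n) (λ x → x ≡ᵇ y) (λ x → elem x u) disj)
      (cong₂ _+_ c1 (count-elem n u du a))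
    where
    disj : ∀ x → (x ≡ᵇ y) ∧ elem x u ≡ false
    disj x with x ≡ᵇ y in exy
    ... | true = trans (cong (λ z → elem z u) (≡ᵇ-sound {x} {y} exy)) ey
    ... | false = refl
    c1 : count (λ x → x ≡ᵇ y) (range n) ≡ 1
    c1 = trans (cong (count (λ x → x ≡ᵇ y)) (range≡interval n))
        (count-≡ᵇ-interval 1 n (proj₁ (∈-range⁻ n y∈)) (s≤s (proj₂ (∈-range⁻ n y∈))))

  injective-word-uses-all : ∀ n w → IsWord n (range n) w → distinct w ≡ true → ∀ {x} → x ∈ range n → elem x w ≡ true
  injective-word-uses-all n w (lw , aw) d {x} x∈ with elem x w in ex
  ... | true = refl
  ... | false = ⊥-elim
      (true≢false (trans (sym (cong not ex)) (count≡0⇒false (λ y → not (elem y w)) (range n) missing x∈)))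
    where
    missing : count (λ y → not (elem y w)) (range n) ≡ 0
    missing = +-cancelʳ-≡ n (count (λ y → not (elem y w)) (range n)) 0
      (trans (cong (count (λ y → not (elem y w)) (range n) +_) (sym (trans (count-elem n w d aw) lw)))
             (trans (count-not (range n) (λ y → elem y w)) (length-range n)))

  -- Removing a letter a from [n] and renumbering.  skip a is the order-preserving map
  -- [n-1] → [n] \ {a}; filtering a out of [n] gives the image of [n-1] under skip a.
  differs : ℕ → ℕ → Bool
  differs a y = not (a ≡ᵇ y)

  count-avoiding : (a : ℕ) (k : ℕ) (A : List ℕ) (R : List ℕ → Bool) →
       count (λ w → not (elem a w) ∧ R w) (words k A) ≡ count R (words k (filterᵇ (differs a) A))
  count-avoiding a zero A R = refl
  count-avoiding a (suc k) A R =
    trans (count-words-suc _ k A)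
    (trans (sumOver-cong A step)
    (trans (sym (sumOver-filterᵇ (differs a) A _)) (sym (count-words-suc R k (filterᵇ (differs a) A)))))
    where
    step : ∀ b → count (λ w → not (elem a (b ∷ w)) ∧ R (b ∷ w)) (words k A)
               ≡ (if differs a b then count (λ w → R (b ∷ w)) (words k (filterᵇ (differs a) A)) else 0)
    step b with a ≡ᵇ b
    ... | true = count-false (words k A)
    ... | false = count-avoiding a k A (λ w → R (b ∷ w))

  count-relabel : (g : ℕ → ℕ) (k : ℕ) (A : List ℕ) (R : List ℕ → Bool) →
            count R (words k (map g A)) ≡ count (λ w → R (map g w)) (words k A)
  count-relabel g zero A R = refl
  count-relabel g (suc k) A R =
    trans (count-words-suc R k (map g A))
    (trans (relabel-letters A)
    (sym (count-words-suc (λ w → R (map g w)) k A)))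
    where
    relabel-letters : (L : List ℕ) → sumOver (map g L) (λ a → count (λ w → R (a ∷ w)) (words k (map g A)))
                          ≡ sumOver L (λ a → count (λ w → R (g a ∷ map g w)) (words k A))
    relabel-letters [] = refl
    relabel-letters (x ∷ L) = cong₂ _+_ (count-relabel g k A (λ w → R (g x ∷ w))) (relabel-letters L)

  skip : ℕ → ℕ → ℕ
  skip a x = if x <ᵇ a then x else suc x

  record OrderEmbedding (φ : ℕ → ℕ) : Set where
    field
      preserves-<ᵇ : ∀ x y → (φ x <ᵇ φ y) ≡ (x <ᵇ y)
      preserves-≡ᵇ : ∀ x y → (φ x ≡ᵇ φ y) ≡ (x ≡ᵇ y)
      fixes-0  : φ 0 ≡ 0
  open OrderEmbedding public

  skip-<ᵇ : ∀ a x y → (skip a x <ᵇ skip a y) ≡ (x <ᵇ y)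
  skip-<ᵇ a x y with x <ᵇ a in ex | y <ᵇ a in ey
  ... | true | true = refl
  ... | true | false = trans
      (<ᵇ-true {x} {suc y} (≤-trans (<ᵇ-sound x a ex) (≤-trans (≮⇒≥ (<ᵇ-sound-false y a ey)) (n≤1+n y))))
      (sym (<ᵇ-true (<-≤-trans (<ᵇ-sound x a ex) (≮⇒≥ (<ᵇ-sound-false y a ey)))))
  ... | false | true = let y<x = <-≤-trans (<ᵇ-sound y a ey) (≮⇒≥ (<ᵇ-sound-false x a ex)) in trans (<ᵇ-false {suc x} {y} (λ p → <-asym (<-trans (n<1+n x) p) y<x)) (sym (<ᵇ-false (λ p → <-asym p y<x)))
  ... | false | false = refl

  skip-≡ᵇ : ∀ a x y → (skip a x ≡ᵇ skip a y) ≡ (x ≡ᵇ y)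
  skip-≡ᵇ a x y with x <ᵇ a in ex | y <ᵇ a in ey
  ... | true | true = refl
  ... | true | false = let x<y = <-≤-trans (<ᵇ-sound x a ex) (≮⇒≥ (<ᵇ-sound-false y a ey)) in trans (≡ᵇ-false {x} {suc y} (λ e → <-irrefl e (<-trans x<y (n<1+n y)))) (sym (≡ᵇ-false (λ e → <-irrefl e x<y)))
  ... | false | true = let y<x = <-≤-trans (<ᵇ-sound y a ey) (≮⇒≥ (<ᵇ-sound-false x a ex)) in trans (≡ᵇ-false {suc x} {y} (λ e → <-irrefl (sym e) (<-trans y<x (n<1+n x)))) (sym (≡ᵇ-false (λ e → <-irrefl (sym e) y<x)))
  ... | false | false = refl

  skip-embedding : ∀ a → 1 ≤ a → OrderEmbedding (skip a)
  skip-embedding (suc a) _ = record { preserves-<ᵇ = skip-<ᵇ (suc a) ; preserves-≡ᵇ = skip-≡ᵇ (suc a) ; fixes-0 = refl }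

  module Embedding (φ : ℕ → ℕ) (emb : OrderEmbedding φ) where
    elem-map : ∀ x w → elem (φ x) (map φ w) ≡ elem x w
    elem-map x [] = refl
    elem-map x (y ∷ w) = cong₂ _∨_ (preserves-≡ᵇ emb x y) (elem-map x w)

    distinct-map : ∀ w → distinct (map φ w) ≡ distinct w
    distinct-map [] = refl
    distinct-map (x ∷ w) = cong₂ (λ u v → not u ∧ v) (elem-map x w) (distinct-map w)

    at-map : ∀ w i → at (map φ w) i ≡ φ (at w i)
    at-map [] i = sym (fixes-0 emb)
    at-map (x ∷ w) zero = sym (fixes-0 emb)
    at-map (x ∷ w) (suc zero) = refl
    at-map (x ∷ w) (suc (suc i)) = at-map w (suc i)

    isPeak-map : ∀ w i → isPeak (map φ w) i ≡ isPeak w i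
    isPeak-map w i rewrite length-map φ w | at-map w (i ∸ 1) | at-map w i | at-map w (i + 1)
      | preserves-<ᵇ emb (at w (i ∸ 1)) (at w i) | preserves-<ᵇ emb (at w (i + 1)) (at w i) = refl

    all-ext : (L : List ℕ) {p q : ℕ → Bool} → (∀ i → p i ≡ q i) → all p L ≡ all q L
    all-ext [] e = refl
    all-ext (x ∷ L) e = cong₂ _∧_ (e x) (all-ext L e)

    hps-map : ∀ S w → hasPeakSet S (map φ w) ≡ hasPeakSet S w
    hps-map S w =
      cong₂ _∧_ (trans (cong (λ L → all (λ i → beq (isPeak (map φ w) i) (elem i S)) (range L)) (length-map φ w))
                       (all-ext (range (length w)) (λ i → cong (λ b → beq b (elem i S)) (isPeak-map w i))))
                (all-ext S (isPeak-map w))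

  filter-differs-id : ∀ a s n → a < s → filterᵇ (differs a) (interval s n) ≡ interval s n
  filter-differs-id a s zero _ = refl
  filter-differs-id a s (suc n) a<s rewrite ≡ᵇ-false {a} {s} (λ e → <-irrefl e a<s) = cong (s ∷_) (filter-differs-id a (suc s) n (<-trans a<s (n<1+n s)))

  map-skip-interval : ∀ a s n → a ≤ s → map (skip a) (interval s n) ≡ interval (suc s) n
  map-skip-interval a s zero _ = refl
  map-skip-interval a s (suc n) a≤s rewrite <ᵇ-false {s} {a} (≤⇒≯ a≤s) = cong (suc s ∷_) (map-skip-interval a (suc s) n (≤-trans a≤s (n≤1+n s)))

  filter-differs-step : ∀ a s n → s < a
      → filterᵇ (differs a) (interval (suc s) (suc n)) ≡ map (skip a) (interval (suc s) n)
      → filterᵇ (differs a) (interval s (suc (suc n))) ≡ map (skip a) (interval s (suc n))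
  filter-differs-step a s n s<a e rewrite ≡ᵇ-false {a} {s} (λ e → <-irrefl (sym e) s<a) | <ᵇ-true s<a = cong (s ∷_) e

  filter-differs-cases : ∀ a s n → s ≤ a → a < s + suc (suc n) →
    (suc s ≤ a → a < suc s + suc n → filterᵇ (differs a) (interval (suc s) (suc n)) ≡ map (skip a) (interval (suc s) n)) →
    filterᵇ (differs a) (interval s (suc (suc n))) ≡ map (skip a) (interval s (suc n))
  filter-differs-cases a s n s≤a a< ih with <-cmp s a
  ... | tri< s<a _ _ = filter-differs-step a s n s<a (ih s<a (subst (a <_) (+-suc s (suc n)) a<))
  ... | tri≈ _ refl _ rewrite ≡ᵇ-true {s} {s} refl = trans (filter-differs-id s (suc s) (suc n) (n<1+n s)) (sym (map-skip-interval s s (suc n) ≤-refl))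
  ... | tri> _ _ a<s = ⊥-elim (<-irrefl refl (<-≤-trans a<s s≤a))

  filter-differs-interval : ∀ a s n → s ≤ a → a < s + n
      → filterᵇ (differs a) (interval s n) ≡ map (skip a) (interval s (n ∸ 1))
  filter-differs-interval a s zero s≤a a< = ⊥-elim
      (<-irrefl refl (≤-trans a< (≤-trans (≤-reflexive (+-identityʳ s)) s≤a)))
  filter-differs-interval a s (suc zero) s≤a a< with <-cmp s a
  ... | tri< s<a _ _ = ⊥-elim
      (<-irrefl refl (≤-trans a< (≤-trans (≤-reflexive (+-suc s 0)) (≤-trans (s≤s (≤-reflexive (+-identityʳ s))) s<a))))
  ... | tri≈ _ refl _ rewrite ≡ᵇ-true {s} {s} refl = refl
  ... | tri> _ _ a<s = ⊥-elim (<-irrefl refl (<-≤-trans a<s s≤a))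
  filter-differs-interval a s (suc (suc n)) s≤a a< = filter-differs-cases a s n s≤a a<
      (filter-differs-interval a (suc s) (suc n))

  filter-differs-range : ∀ a n → 1 ≤ a → a ≤ n → filterᵇ (differs a) (range n) ≡ map (skip a) (range (n ∸ 1))
  filter-differs-range a n 1≤a a≤n rewrite range≡interval n | range≡interval (n ∸ 1) = filter-differs-interval a 1 n 1≤a (s≤s a≤n)

  count-avoiding-letter : ∀ n a k → 1 ≤ a → a ≤ n → (R : List ℕ → Bool) →
    count (λ w → not (elem a w) ∧ R w) (words k (range n)) ≡ count (λ v → R (map (skip a) v)) (words k (range (n ∸ 1)))
  count-avoiding-letter n a k 1≤a a≤n R =
    trans (count-avoiding a k (range n) R)
    (trans (cong (λ L → count R (words k L)) (filter-differs-range a n 1≤a a≤n))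
    (count-relabel (skip a) k (range (n ∸ 1)) R))

  injWords : ℕ → ℕ → (List ℕ → Bool) → ℕ
  injWords n p Q = count (λ w → distinct w ∧ Q w) (words p (range n))

  count-avoiding-peakSet : ∀ n a k T → 1 ≤ a → a ≤ n →
    count (λ w → not (elem a w) ∧ (distinct w ∧ hasPeakSet T w)) (words k (range n)) ≡ injWords (n ∸ 1) k (hasPeakSet T)
  count-avoiding-peakSet n a k T 1≤a a≤n =
    trans (count-avoiding-letter n a k 1≤a a≤n (λ w → distinct w ∧ hasPeakSet T w))
    (count-cong (words k (range (n ∸ 1))) (λ v → cong₂ _∧_ (distinct-map v) (hps-map T v)))
    where open Embedding (skip a) (skip-embedding a 1≤a)

  count-first-letter : (n j : ℕ) (R : List ℕ → Bool) →
    count (λ w → distinct w ∧ R w) (words (suc j) (range n))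
    ≡ sumOver (range n) (λ a → count (λ v → distinct v ∧ R (a ∷ map (skip a) v)) (words j (range (n ∸ 1))))
  count-first-letter n j R = trans (count-words-suc _ j (range n)) (sumOver-cong∈ (range n) step)
    where
    step : ∀ {a} → a ∈ range n → count (λ w → distinct (a ∷ w) ∧ R (a ∷ w)) (words j (range n))
                                ≡ count (λ v → distinct v ∧ R (a ∷ map (skip a) v)) (words j (range (n ∸ 1)))
    step {a} a∈ with ∈-range⁻ n a∈
    ... | 1≤a , a≤n =
      trans (count-cong (words j (range n)) (λ w → ∧-assoc (not (elem a w)) (distinct w) (R (a ∷ w))))
      (trans (count-avoiding-letter n a j 1≤a a≤n (λ w → distinct w ∧ R (a ∷ w)))
      (count-cong (words j (range (n ∸ 1))) (λ v → cong (_∧ R (a ∷ map (skip a) v)) (Embedding.distinct-map (skip a) (skip-embedding a 1≤a) v))))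

  binom : ℕ → ℕ → ℕ
  binom n zero = 1
  binom zero (suc k) = 0
  binom (suc n) (suc k) = binom n k + binom n (suc k)

  binom≡C : ∀ n k → binom n k ≡ n C k
  binom≡C n zero = refl
  binom≡C zero (suc k) = refl
  binom≡C (suc n) (suc k) = trans (cong₂ _+_ (binom≡C n k) (binom≡C n (suc k))) (nCk+nC[k+1]≡[n+1]C[k+1] n k)

  binom-1 : ∀ n → binom n 1 ≡ n
  binom-1 zero = refl
  binom-1 (suc n) = cong suc (binom-1 n)

  binom-absorb : ∀ n k → suc k * binom (suc n) (suc k) ≡ suc n * binom n k
  binom-absorb zero zero = refl
  binom-absorb zero (suc k) = *-zeroʳ (suc (suc k))
  binom-absorb (suc n) zero = trans (+-identityʳ _)
      (trans (cong suc (binom-1 (suc n))) (sym (*-identityʳ (suc (suc n)))))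
  binom-absorb (suc n) (suc k) =
    begin
      suc (suc k) * (binom (suc n) (suc k) + binom (suc n) (suc (suc k)))
    ≡⟨ *-distribˡ-+ (suc (suc k)) (binom (suc n) (suc k)) _ ⟩
      suc (suc k) * binom (suc n) (suc k) + suc (suc k) * binom (suc n) (suc (suc k))
    ≡⟨ cong (suc (suc k) * binom (suc n) (suc k) +_) (binom-absorb n (suc k)) ⟩
      (binom (suc n) (suc k) + suc k * binom (suc n) (suc k)) + suc n * binom n (suc k)
    ≡⟨ cong (λ z → (binom (suc n) (suc k) + z) + suc n * binom n (suc k)) (binom-absorb n k) ⟩
      (binom (suc n) (suc k) + suc n * binom n k) + suc n * binom n (suc k)
    ≡⟨ +-assoc (binom (suc n) (suc k)) _ _ ⟩
      binom (suc n) (suc k) + (suc n * binom n k + suc n * binom n (suc k))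
    ≡⟨ cong (binom (suc n) (suc k) +_) (sym (*-distribˡ-+ (suc n) (binom n k) (binom n (suc k)))) ⟩
      suc (suc n) * binom (suc n) (suc k)
    ∎
    where open ≡-Reasoning

  binom-shift : ∀ m p → p ≤ suc m → (suc m ∸ p) * binom (suc m) p ≡ suc m * binom m p
  binom-shift m zero _ = refl
  binom-shift m (suc k) p≤ = +-cancelʳ-≡ (suc k * binom (suc m) (suc k)) _ _ (
    begin
      (suc m ∸ suc k) * binom (suc m) (suc k) + suc k * binom (suc m) (suc k)
    ≡⟨ sym (*-distribʳ-+ (binom (suc m) (suc k)) (suc m ∸ suc k) (suc k)) ⟩
      (suc m ∸ suc k + suc k) * binom (suc m) (suc k)
    ≡⟨ cong (_* binom (suc m) (suc k)) (m∸n+n≡m p≤) ⟩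
      suc m * (binom m k + binom m (suc k))
    ≡⟨ *-distribˡ-+ (suc m) (binom m k) (binom m (suc k)) ⟩
      suc m * binom m k + suc m * binom m (suc k)
    ≡⟨ +-comm (suc m * binom m k) _ ⟩
      suc m * binom m (suc k) + suc m * binom m k
    ≡⟨ cong (suc m * binom m (suc k) +_) (sym (binom-absorb m k)) ⟩
      suc m * binom m (suc k) + suc k * binom (suc m) (suc k)
    ∎)
    where open ≡-Reasoning

  binom-diag : ∀ n → binom n n ≡ 1
  binom-diag n = trans (binom≡C n n) (nCn≡1 n)

  binom-zero : ∀ n k → n < k → binom n k ≡ 0
  binom-zero zero (suc k) _ = refl
  binom-zero (suc n) (suc k) (s≤s n<k) = cong₂ _+_ (binom-zero n k n<k) (binom-zero n (suc k) (≤-trans n<k (n≤1+n k)))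

  peak-bounds : ∀ w i → isPeak w i ≡ true → (2 ≤ i) × (i < length w)
  peak-bounds w i e = ≤ᵇ-sound {2} {i} (∧-true-l e) , <ᵇ-sound i (length w) (∧-true-l (∧-true-r {2 ≤ᵇ i} e))

  peak-right : ∀ w i → isPeak w i ≡ true → (at w (i + 1) <ᵇ at w i) ≡ true
  peak-right w i e = ∧-true-r {at w (i ∸ 1) <ᵇ at w i} (∧-true-r {i <ᵇ length w} (∧-true-r {2 ≤ᵇ i} e))

  peak-left : ∀ w i → isPeak w i ≡ true → (at w (i ∸ 1) <ᵇ at w i) ≡ true
  peak-left w i e = ∧-true-l (∧-true-r {i <ᵇ length w} (∧-true-r {2 ≤ᵇ i} e))

  peaks-not-adjacent : ∀ w i → isPeak w i ≡ true → isPeak w (suc i) ≡ false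
  peaks-not-adjacent w i e = ≢true⇒false
      (λ e' → <-asym (<ᵇ-sound (at w (suc i)) (at w i) (trans (cong (λ z → at w z <ᵇ at w i) (+-comm 1 i)) (peak-right w i e))) (<ᵇ-sound (at w i) (at w (suc i)) (peak-left w (suc i) e')))

  PeakSet : List ℕ → List ℕ → Set
  PeakSet S w = ∀ i → isPeak w i ≡ elem i S

  hasPeakSet⇒PeakSet : ∀ S w → hasPeakSet S w ≡ true → PeakSet S w
  hasPeakSet⇒PeakSet S w e i with isPeak w i in ep
  ... | true = sym
      (trans (sym (cong (λ b → beq b (elem i S)) ep)) (all⇒∈ (λ i → beq (isPeak w i) (elem i S)) (range (length w)) {i} (∧-true-l e)
                   (∈-range⁺ (length w) (≤-trans (s≤s z≤n) (proj₁ (peak-bounds w i ep))) (<⇒≤ (proj₂ (peak-bounds w i ep))))))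
  ... | false = sym
      (≢true⇒false (λ el → false≢true (trans (sym ep) (all⇒∈ (isPeak w) S (∧-true-r {all (λ i → beq (isPeak w i) (elem i S)) (range (length w))} e) (elem⇒∈ i S el)))))

  beq-refl : ∀ b → beq b b ≡ true
  beq-refl true = refl
  beq-refl false = refl

  PeakSet⇒hasPeakSet : ∀ S w → PeakSet S w → hasPeakSet S w ≡ true
  PeakSet⇒hasPeakSet S w h rewrite ∈⇒all (λ i → beq (isPeak w i) (elem i S)) (range (length w)) (λ {i} _ → trans (cong (λ b → beq b (elem i S)) (h i)) (beq-refl (elem i S)))
    = ∈⇒all (isPeak w) S (λ {i} m → trans (h i) (∈⇒elem S m))

  hasPeakSet-cong : ∀ S S' w → (∀ i → elem i S ≡ elem i S') → hasPeakSet S w ≡ hasPeakSet S' w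
  hasPeakSet-cong S S' w h = ⇔⇒≡
      (λ e → PeakSet⇒hasPeakSet S' w (λ i → trans (hasPeakSet⇒PeakSet S w e i) (h i)))
      (λ e → PeakSet⇒hasPeakSet S w (λ i → trans (hasPeakSet⇒PeakSet S' w e i) (sym (h i))))

  isPeak-cong : ∀ w w' i i' → (2 ≤ᵇ i) ≡ (2 ≤ᵇ i') → (i <ᵇ length w) ≡ (i' <ᵇ length w') →
    at w (i ∸ 1) ≡ at w' (i' ∸ 1) → at w i ≡ at w' i' → at w (i + 1) ≡ at w' (i' + 1) → isPeak w i ≡ isPeak w' i'
  isPeak-cong w w' i i' e1 e2 e3 e4 e5 = cong₂ _∧_ e1 (cong₂ _∧_ e2 (cong₂ _∧_ (cong₂ _<ᵇ_ e3 e4) (cong₂ _<ᵇ_ e5 e4)))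

  isPeak-intro : ∀ w i → (2 ≤ᵇ i) ≡ true → (i <ᵇ length w) ≡ true → (at w (i ∸ 1) <ᵇ at w i) ≡ true
      → (at w (i + 1) <ᵇ at w i) ≡ true → isPeak w i ≡ true
  isPeak-intro w i e1 e2 e3 e4 = cong₂ _∧_ e1 (cong₂ _∧_ e2 (cong₂ _∧_ e3 e4))

  at-++l : ∀ u v i → 1 ≤ i → i ≤ length u → at (u ++ v) i ≡ at u i
  at-++l (x ∷ u) v (suc zero) _ _ = refl
  at-++l (x ∷ u) v (suc (suc i)) _ (s≤s le) = at-++l u v (suc i) (s≤s z≤n) le

  at-++r : ∀ u v j → at (u ++ v) (length u + suc j) ≡ at v (suc j)
  at-++r [] v j = refl
  at-++r (x ∷ u) v j rewrite +-suc (length u) j = trans (sym (cong (at (u ++ v)) (+-suc (length u) j))) (at-++r u v j)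

  <ᵇ-+-cancelˡ : ∀ a x y → (a + x <ᵇ a + y) ≡ (x <ᵇ y)
  <ᵇ-+-cancelˡ zero x y = refl
  <ᵇ-+-cancelˡ (suc a) x y = <ᵇ-+-cancelˡ a x y

  isPeak-++-left : ∀ u v i → i < length u → isPeak (u ++ v) i ≡ isPeak u i
  isPeak-++-left u v zero _ = refl
  isPeak-++-left u v (suc zero) _ = refl
  isPeak-++-left u v (suc (suc i)) lt =
    isPeak-cong (u ++ v) u (suc (suc i)) (suc (suc i)) refl
      (trans (<ᵇ-true (≤-trans lt (subst (length u ≤_) (sym (length-++ u)) (m≤m+n (length u) (length v))))) (sym (<ᵇ-true lt)))
      (at-++l u v (suc i) (s≤s z≤n) (≤-trans (n≤1+n _) (<⇒≤ lt)))
      (at-++l u v (suc (suc i)) (s≤s z≤n) (<⇒≤ lt))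
      (at-++l u v (suc (suc i) + 1) (s≤s z≤n) (subst (_≤ length u) (+-comm 1 (suc (suc i))) lt))

  isPeak-++-right : ∀ u v j → 2 ≤ j → isPeak (u ++ v) (length u + j) ≡ isPeak v j
  isPeak-++-right u v zero ()
  isPeak-++-right u v (suc zero) (s≤s ())
  isPeak-++-right u v (suc (suc j)) _ =
    isPeak-cong (u ++ v) v (length u + suc (suc j)) (suc (suc j))
      (≤ᵇ-true (≤-trans (s≤s (s≤s z≤n)) (m≤n+m (suc (suc j)) (length u))))
      (trans (cong (length u + suc (suc j) <ᵇ_) (length-++ u)) (<ᵇ-+-cancelˡ (length u) (suc (suc j)) (length v)))
      (trans (cong (λ z → at (u ++ v) (z ∸ 1)) (+-suc (length u) (suc j))) (at-++r u v j))
      (at-++r u v (suc j))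
      (trans (cong (at (u ++ v)) (+-assoc (length u) (suc (suc j)) 1)) (at-++r u v (suc (j + 1))))

  p+j≢p : ∀ p j → 1 ≤ j → p + j ≢ p
  p+j≢p p j h e = <-irrefl (sym (+-cancelˡ-≡ p j 0 (trans e (sym (+-identityʳ p))))) h

  p+j≢1+p : ∀ p j → 2 ≤ j → p + j ≢ suc p
  p+j≢1+p p j h e = <-irrefl (sym (+-cancelˡ-≡ p j 1 (trans e (+-comm 1 p)))) h

  peakless : List ℕ → Bool
  peakless = hasPeakSet []

  peaklessCount : ℕ → ℕ
  peaklessCount k = injWords k k peakless

  peaklessPerm : List ℕ → Bool
  peaklessPerm w = distinct w ∧ peakless w

  countPeaks : List ℕ → ℕ → ℕ
  countPeaks S n = count (λ w → distinct w ∧ hasPeakSet S w) (words n (range n))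

  countP≡countPeaks : ∀ S n → countP S n ≡ countPeaks S n
  countP≡countPeaks S n = trans
      (length-filter≡count (hasPeakSet S) (filter (λ w → T? (distinct w)) (words n (range n))))
      (count-filter distinct (hasPeakSet S) (words n (range n)))

  -- Double counting of pairs (injective word u of length p over [n+1], letter x ∉ u):
  -- (n+1-p) · #words over [n+1] = (n+1) · #words over [n], for words with peak set T.
  double-count : (n p : ℕ) (T : List ℕ)
      → (suc n ∸ p) * injWords (suc n) p (hasPeakSet T) ≡ suc n * injWords n p (hasPeakSet T)
  double-count n p T =
    begin
      (suc n ∸ p) * count D W
    ≡⟨ *-comm (suc n ∸ p) (count D W) ⟩
      count D W * (suc n ∸ p)
    ≡⟨ sym (sumOver-* W (λ u → χ (D u)) (suc n ∸ p)) ⟩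
      sumOver W (λ u → χ (D u) * (suc n ∸ p))
    ≡⟨ sumOver-cong-words p R missing-letters ⟩
      sumOver W (λ u → count (λ x → D u ∧ not (elem x u)) R)
    ≡⟨ sym (sumOver-swap R W (λ x u → D u ∧ not (elem x u))) ⟩
      sumOver R (λ x → count (λ u → D u ∧ not (elem x u)) W)
    ≡⟨ sumOver-cong∈ R avoiding ⟩
      sumOver R (λ _ → injWords n p Q)
    ≡⟨ trans (sumOver-const R (injWords n p Q)) (cong (_* injWords n p Q) (length-range (suc n))) ⟩
      suc n * injWords n p Q
    ∎
    where
    open ≡-Reasoning
    Q = hasPeakSet T
    D : List ℕ → Bool
    D u = distinct u ∧ Q u
    R = range (suc n)
    W = words p R
    missing-letters : ∀ u → IsWord p R u → χ (D u) * (suc n ∸ p) ≡ count (λ x → D u ∧ not (elem x u)) R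
    missing-letters u (lu , au) with D u in eD
    ... | false = sym (count-false R)
    ... | true = trans (+-identityʳ _) (sym (trans (sym (m+n∸n≡m (count (λ x → not (elem x u)) R) p))
         (cong (_∸ p) (trans (cong (count (λ x → not (elem x u)) R +_) (sym (trans (count-elem (suc n) u (∧-true-l eD) au) lu)))
           (trans (count-not R (λ x → elem x u)) (length-range (suc n)))))))
    avoiding : ∀ {x} → x ∈ R → count (λ u → D u ∧ not (elem x u)) W ≡ injWords n p Q
    avoiding {x} x∈ with ∈-range⁻ (suc n) x∈
    ... | 1≤x , x≤ = trans (count-cong W (λ u → ∧-comm (D u) (not (elem x u))))
        (count-avoiding-peakSet (suc n) x p T 1≤x x≤)

  -- Hence the injective words of length p over [d+p] with peak set T are obtained by
  -- choosing p letters and a permutation of them: C(d+p,p) · #P(T;p).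
  injWords-binomial : (p d : ℕ) (T : List ℕ)
      → injWords (d + p) p (hasPeakSet T) ≡ binom (d + p) p * injWords p p (hasPeakSet T)
  injWords-binomial p zero T = sym (trans (cong (_* injWords p p (hasPeakSet T)) (binom-diag p)) (+-identityʳ _))
  injWords-binomial p (suc d) T = *-cancelˡ-≡ _ _ (suc d) (
    begin
      suc d * injWords (suc d + p) p Q
    ≡⟨ cong (_* injWords (suc d + p) p Q) (sym (m+n∸n≡m (suc d) p)) ⟩
      (suc (d + p) ∸ p) * injWords (suc (d + p)) p Q
    ≡⟨ double-count (d + p) p T ⟩
      suc (d + p) * injWords (d + p) p Q
    ≡⟨ cong (suc (d + p) *_) (injWords-binomial p d T) ⟩
      suc (d + p) * (binom (d + p) p * injWords p p Q)
    ≡⟨ sym (*-assoc (suc (d + p)) (binom (d + p) p) _) ⟩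
      (suc (d + p) * binom (d + p) p) * injWords p p Q
    ≡⟨ cong (_* injWords p p Q) (sym (binom-shift (d + p) p (≤-trans (m≤n+m p d) (n≤1+n _)))) ⟩
      ((suc (d + p) ∸ p) * binom (suc (d + p)) p) * injWords p p Q
    ≡⟨ cong (λ z → (z * binom (suc (d + p)) p) * injWords p p Q) (m+n∸n≡m (suc d) p) ⟩
      (suc d * binom (suc (d + p)) p) * injWords p p Q
    ≡⟨ *-assoc (suc d) (binom (suc (d + p)) p) (injWords p p Q) ⟩
      suc d * (binom (suc d + p) p * injWords p p Q)
    ∎)
    where
    open ≡-Reasoning
    Q = hasPeakSet T

  -- Permutations of [p+k] whose prefix of length p satisfies Q₁ and whose suffix is
  -- peakless: choose the prefix as an injective word, then a peakless pattern for the rest.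
  count-prefix-peakless-suffix : (p k : ℕ) (Q1 : List ℕ → Bool) →
    count (λ w → distinct w ∧ (Q1 (take p w) ∧ peakless (drop p w))) (words (p + k) (range (p + k)))
    ≡ injWords (p + k) p Q1 * peaklessCount k
  count-prefix-peakless-suffix zero k Q1 with Q1 []
  ... | true = sym (+-identityʳ (peaklessCount k))
  ... | false = trans (count-cong (words k (range k)) (λ w → ∧-zeroʳ (distinct w))) (count-false (words k (range k)))
  count-prefix-peakless-suffix (suc p) k Q1 =
    trans (count-first-letter (suc (p + k)) (p + k) (λ w → Q1 (take (suc p) w) ∧ peakless (drop (suc p) w)))
    (trans (sumOver-cong∈ (range (suc (p + k))) step)
    (trans (sumOver-* (range (suc (p + k))) (λ a → injWords (p + k) p (λ u → Q1 (a ∷ map (skip a) u))) (peaklessCount k))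
    (cong (_* peaklessCount k) (sym (count-first-letter (suc (p + k)) p Q1)))))
    where
    step : ∀ {a} → a ∈ range (suc (p + k)) →
      count
          (λ v → distinct v ∧ (Q1 (a ∷ take p (map (skip a) v)) ∧ peakless (drop p (map (skip a) v))))
          (words (p + k) (range (p + k)))
      ≡ injWords (p + k) p (λ u → Q1 (a ∷ map (skip a) u)) * peaklessCount k
    step {a} a∈ =
      trans (count-cong (words (p + k) (range (p + k)))
        (λ v → cong (distinct v ∧_) (cong₂ _∧_ (cong (λ u → Q1 (a ∷ u)) (take-map p v))
          (trans (cong peakless (drop-map p v)) (Embedding.hps-map (skip a) (skip-embedding a (proj₁ (∈-range⁻ (suc (p + k)) a∈))) [] (drop p v))))))
      (count-prefix-peakless-suffix p k (λ u → Q1 (a ∷ map (skip a) u)))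

  module Splitting (p : ℕ) (S₁ : List ℕ) (above-p-absent : ∀ i → p ≤ i → elem i S₁ ≡ false) where

    T₂ : List ℕ
    T₂ = p ∷ S₁
    T₃ : List ℕ
    T₃ = suc p ∷ S₁

    AgreesOffJunction : List ℕ → Set
    AgreesOffJunction w = ∀ i → i ≢ p → i ≢ suc p → isPeak w i ≡ elem i S₁

    module Concatenation (u v : List ℕ) (|u|≡p : length u ≡ p) where
      w = u ++ v

      prefix-suffix⇒agrees : hasPeakSet S₁ u ≡ true → peakless v ≡ true → AgreesOffJunction w
      prefix-suffix⇒agrees hu hv i i≢p i≢sp with <-cmp i p
      ... | tri< i<p _ _ = trans (isPeak-++-left u v i (subst (i <_) (sym |u|≡p) i<p)) (hasPeakSet⇒PeakSet S₁ u hu i)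
      ... | tri≈ _ i≡p _ = ⊥-elim (i≢p i≡p)
      ... | tri> _ _ p<i = trans (cong (isPeak w) (sym e))
          (trans (isPeak-++-right u v (i ∸ p) j≥2) (trans (hasPeakSet⇒PeakSet [] v hv (i ∸ p)) (sym (above-p-absent i (<⇒≤ p<i)))))
        where
        e : length u + (i ∸ p) ≡ i
        e = trans (cong (_+ (i ∸ p)) |u|≡p) (m+[n∸m]≡n (<⇒≤ p<i))
        j≥2 : 2 ≤ i ∸ p
        j≥2 with i ∸ p in eq
        ... | zero = ⊥-elim (<-irrefl refl (<-≤-trans p<i (m∸n≡0⇒m≤n eq)))
        ... | suc zero = ⊥-elim (i≢sp (trans (sym (m+[n∸m]≡n (<⇒≤ p<i))) (trans (cong (p +_) eq) (+-comm p 1))))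
        ... | suc (suc k) = s≤s (s≤s z≤n)

      agrees⇒prefix-suffix : AgreesOffJunction w → (hasPeakSet S₁ u ≡ true) × (peakless v ≡ true)
      agrees⇒prefix-suffix c = PeakSet⇒hasPeakSet S₁ u pu , PeakSet⇒hasPeakSet [] v pv
        where
        pu : PeakSet S₁ u
        pu i with i <? p
        ... | yes i<p = trans (sym (isPeak-++-left u v i (subst (i <_) (sym |u|≡p) i<p)))
            (c i (λ e → <-irrefl e i<p) (λ e → <-irrefl e (<-trans i<p (n<1+n p))))
        ... | no i≮p = trans
            (≢true⇒false (λ e → i≮p (subst (i <_) |u|≡p (proj₂ (peak-bounds u i e)))))
            (sym (above-p-absent i (≮⇒≥ i≮p)))
        pv : PeakSet [] v
        pv j with 2 ≤? j
        ... | no j<2 = ≢true⇒false (λ e → j<2 (proj₁ (peak-bounds v j e)))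
        ... | yes j≥2 = trans (sym (isPeak-++-right u v j j≥2))
            (trans (cong (λ z → isPeak w (z + j)) |u|≡p)
            (trans (c (p + j) (p+j≢p p j (≤-trans (s≤s z≤n) j≥2)) (p+j≢1+p p j j≥2))
                   (above-p-absent (p + j) (m≤m+n p j))))

      module Extension (T : List ℕ) (T-agrees : ∀ i → i ≢ p → i ≢ suc p → elem i T ≡ elem i S₁) where
        peakSet⇒agrees : hasPeakSet T w ≡ true
            → AgreesOffJunction w × (isPeak w p ≡ elem p T) × (isPeak w (suc p) ≡ elem (suc p) T)
        peakSet⇒agrees e = (λ i a b → trans (hasPeakSet⇒PeakSet T w e i) (T-agrees i a b)) , hasPeakSet⇒PeakSet T w e p , hasPeakSet⇒PeakSet T w e
            (suc p)
        agrees⇒peakSet : AgreesOffJunction w → (isPeak w p ≡ elem p T)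
            → (isPeak w (suc p) ≡ elem (suc p) T) → hasPeakSet T w ≡ true
        agrees⇒peakSet c a b = PeakSet⇒hasPeakSet T w f
          where
          f : PeakSet T w
          f i with i ≟ p | i ≟ suc p
          ... | yes refl | _ = a
          ... | no _ | yes refl = b
          ... | no x | no y = trans (c i x y) (sym (T-agrees i x y))

      S₁-agrees : ∀ i → i ≢ p → i ≢ suc p → elem i S₁ ≡ elem i S₁
      S₁-agrees i _ _ = refl
      T₂-agrees : ∀ i → i ≢ p → i ≢ suc p → elem i T₂ ≡ elem i S₁
      T₂-agrees i a _ = cong (_∨ elem i S₁) (≡ᵇ-false a)
      T₃-agrees : ∀ i → i ≢ p → i ≢ suc p → elem i T₃ ≡ elem i S₁
      T₃-agrees i _ b = cong (_∨ elem i S₁) (≡ᵇ-false b)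

      module ForS₁ = Extension S₁ S₁-agrees
      module ForT₂ = Extension T₂ T₂-agrees
      module ForT₃ = Extension T₃ T₃-agrees

      p+1∉S₁ : elem (suc p) S₁ ≡ false
      p+1∉S₁ = above-p-absent (suc p) (n≤1+n p)
      p∉S₁ : elem p S₁ ≡ false
      p∉S₁ = above-p-absent p ≤-refl
      p∈T₂ : elem p T₂ ≡ true
      p∈T₂ = cong (_∨ elem p S₁) (≡ᵇ-true {p} refl)
      p+1∉T₂ : elem (suc p) T₂ ≡ false
      p+1∉T₂ = trans (cong (_∨ elem (suc p) S₁) (≡ᵇ-false (λ e → <-irrefl (sym e) (n<1+n p)))) p+1∉S₁
      p∉T₃ : elem p T₃ ≡ false
      p∉T₃ = trans (cong (_∨ elem p S₁) (≡ᵇ-false (λ e → <-irrefl e (n<1+n p)))) p∉S₁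
      p+1∈T₃ : elem (suc p) T₃ ≡ true
      p+1∈T₃ = cong (_∨ elem (suc p) S₁) (≡ᵇ-true {suc p} refl)

      none-of-three : (AgreesOffJunction w → false ≡ true)
          → 0 ≡ χ (hasPeakSet S₁ w) + χ (hasPeakSet T₂ w) + χ (hasPeakSet T₃ w)
      none-of-three h rewrite ≢true⇒false {hasPeakSet S₁ w} (λ e → false≢true (h (proj₁ (ForS₁.peakSet⇒agrees e))))
                    | ≢true⇒false {hasPeakSet T₂ w} (λ e → false≢true (h (proj₁ (ForT₂.peakSet⇒agrees e))))
                    | ≢true⇒false {hasPeakSet T₃ w} (λ e → false≢true (h (proj₁ (ForT₃.peakSet⇒agrees e)))) = refl

      -- The splitting identity: u has peak set S₁ and v is peakless iff w has exactly one of
      -- the peak sets S₁, S₁ ∪ {p}, S₁ ∪ {p+1}; which one is decided by the peaks of w at p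
      -- and p+1 (not both, as peaks are never adjacent).
      split-indicator : χ (hasPeakSet S₁ u ∧ peakless v) ≡ χ (hasPeakSet S₁ w) + χ (hasPeakSet T₂ w) + χ (hasPeakSet T₃ w)
      split-indicator with hasPeakSet S₁ u in eu | peakless v in ev
      ... | true | true = by-junction-peaks (isPeak w p) (isPeak w (suc p)) refl refl
        where
        c = prefix-suffix⇒agrees eu ev
        by-junction-peaks : ∀ a b → isPeak w p ≡ a → isPeak w (suc p) ≡ b →
             1 ≡ χ (hasPeakSet S₁ w) + χ (hasPeakSet T₂ w) + χ (hasPeakSet T₃ w)
        by-junction-peaks true true ea eb = ⊥-elim (true≢false (trans (sym eb) (peaks-not-adjacent w p ea)))
        by-junction-peaks true false ea eb
          rewrite ≢true⇒false {hasPeakSet S₁ w} (λ e → true≢false (trans (sym ea) (trans (proj₁ (proj₂ (ForS₁.peakSet⇒agrees e))) p∉S₁)))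
                | ForT₂.agrees⇒peakSet c (trans ea (sym p∈T₂)) (trans eb (sym p+1∉T₂))
                | ≢true⇒false {hasPeakSet T₃ w} (λ e → true≢false (trans (sym ea) (trans (proj₁ (proj₂ (ForT₃.peakSet⇒agrees e))) p∉T₃))) = refl
        by-junction-peaks false true ea eb
          rewrite ≢true⇒false {hasPeakSet S₁ w} (λ e → true≢false (trans (sym eb) (trans (proj₂ (proj₂ (ForS₁.peakSet⇒agrees e))) p+1∉S₁)))
                | ≢true⇒false {hasPeakSet T₂ w}
                    (λ e → true≢false (trans (sym eb) (trans (proj₂ (proj₂ (ForT₂.peakSet⇒agrees e))) p+1∉T₂)))
                | ForT₃.agrees⇒peakSet c (trans ea (sym p∉T₃)) (trans eb (sym p+1∈T₃)) = refl
        by-junction-peaks false false ea eb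
          rewrite ForS₁.agrees⇒peakSet c (trans ea (sym p∉S₁)) (trans eb (sym p+1∉S₁))
                | ≢true⇒false {hasPeakSet T₂ w}
                    (λ e → false≢true (trans (sym ea) (trans (proj₁ (proj₂ (ForT₂.peakSet⇒agrees e))) p∈T₂)))
                | ≢true⇒false {hasPeakSet T₃ w} (λ e → false≢true (trans (sym eb) (trans (proj₂ (proj₂ (ForT₃.peakSet⇒agrees e))) p+1∈T₃))) = refl
      ... | true | false = none-of-three (λ c → trans (sym ev) (proj₂ (agrees⇒prefix-suffix c)))
      ... | false | _ = none-of-three (λ c → trans (sym eu) (proj₁ (agrees⇒prefix-suffix c)))

  peak-recurrence : (p k : ℕ) (S1 : List ℕ) (H1 : ∀ i → p ≤ i → elem i S1 ≡ false) →
    binom (p + k) p * countPeaks S1 p * peaklessCount k ≡ countPeaks S1 (p + k) + countPeaks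
        (p ∷ S1) (p + k) + countPeaks (suc p ∷ S1) (p + k)
  peak-recurrence p k S1 H1 =
    begin
      binom (p + k) p * countPeaks S1 p * peaklessCount k
    ≡⟨ cong (_* peaklessCount k) (sym (subst (λ z → injWords z p (hasPeakSet S1) ≡ binom z p * countPeaks S1 p) (+-comm k p) (injWords-binomial p k S1))) ⟩
      injWords (p + k) p (hasPeakSet S1) * peaklessCount k
    ≡⟨ sym (count-prefix-peakless-suffix p k (hasPeakSet S1)) ⟩
      count X W
    ≡⟨ sumOver-cong-words (p + k) (range (p + k)) split-each ⟩
      sumOver W (λ w → χ (D1 w) + χ (D2 w) + χ (D3 w))
    ≡⟨ trans (sumOver-+ W _ (λ w → χ (D3 w))) (cong (_+ count D3 W) (sumOver-+ W (λ w → χ (D1 w)) (λ w → χ (D2 w)))) ⟩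
      count D1 W + count D2 W + count D3 W
    ∎
    where
    open ≡-Reasoning
    W = words (p + k) (range (p + k))
    X : List ℕ → Bool
    X w = distinct w ∧ (hasPeakSet S1 (take p w) ∧ peakless (drop p w))
    D1 D2 D3 : List ℕ → Bool
    D1 w = distinct w ∧ hasPeakSet S1 w
    D2 w = distinct w ∧ hasPeakSet (p ∷ S1) w
    D3 w = distinct w ∧ hasPeakSet (suc p ∷ S1) w
    split-each : ∀ w → IsWord (p + k) (range (p + k)) w → χ (X w) ≡ χ (D1 w) + χ (D2 w) + χ (D3 w)
    split-each w (lw , _) with distinct w
    ... | false = refl
    ... | true = subst
        (λ z → χ (hasPeakSet S1 (take p w) ∧ peakless (drop p w)) ≡ χ (hasPeakSet S1 z) + χ (hasPeakSet (p ∷ S1) z) + χ (hasPeakSet (suc p ∷ S1) z))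
                   (take++drop≡id p w)
                   (Splitting.Concatenation.split-indicator p S1 H1 (take p w) (drop p w) (trans (length-take p w) (m≤n⇒m⊓n≡m (subst (p ≤_) (sym lw) (m≤m+n p k)))))

  -- There are 2^(k-1) peakless permutations of [k]: the maximum of a peakless permutation
  -- is its first or its last letter, and removing it leaves a peakless permutation.
  firstLetter : List ℕ → ℕ
  firstLetter [] = 0
  firstLetter (x ∷ _) = x

  lastLetter : List ℕ → ℕ
  lastLetter [] = 0
  lastLetter (x ∷ []) = x
  lastLetter (x ∷ y ∷ r) = lastLetter (y ∷ r)

  lastLetter-snoc : ∀ u c → lastLetter (u ++ c ∷ []) ≡ c
  lastLetter-snoc [] c = refl
  lastLetter-snoc (x ∷ []) c = refl
  lastLetter-snoc (x ∷ y ∷ r) c = lastLetter-snoc (y ∷ r) c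

  at-length : ∀ x r → at (x ∷ r) (length (x ∷ r)) ≡ lastLetter (x ∷ r)
  at-length x [] = refl
  at-length x (y ∷ r) = at-length y r

  lastLetter-∈ : ∀ x r → lastLetter (x ∷ r) ∈ (x ∷ r)
  lastLetter-∈ x [] = here refl
  lastLetter-∈ x (y ∷ r) = there (lastLetter-∈ y r)

  interior-max-peak : ∀ a pre n b post → lastLetter (a ∷ pre) < n → b < n →
    isPeak ((a ∷ pre) ++ n ∷ b ∷ post) (suc (length (a ∷ pre))) ≡ true
  interior-max-peak a pre n b post l1 l2 =
    isPeak-intro w i refl
      (<ᵇ-true (subst (i <_) (sym (length-++ (a ∷ pre))) (subst (suc i ≤_) (sym (trans (+-suc (length u) (suc (length post))) (cong suc (+-suc (length u) (length post))))) (s≤s (s≤s (m≤m+n (length u) (length post)))))))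
      (trans (cong₂ _<ᵇ_ (trans (at-++l (a ∷ pre) (n ∷ b ∷ post) (length (a ∷ pre)) (s≤s z≤n) ≤-refl) (at-length a pre)) atn) (<ᵇ-true l1))
      (trans (cong₂ _<ᵇ_ (trans (cong (at w) e2) (at-++r (a ∷ pre) (n ∷ b ∷ post) 1)) atn) (<ᵇ-true l2))
    where
    u = a ∷ pre
    w = u ++ n ∷ b ∷ post
    i = suc (length u)
    atn : at w i ≡ n
    atn = trans (cong (at w) (+-comm 1 (length u))) (at-++r u (n ∷ b ∷ post) 0)
    e2 : i + 1 ≡ length u + 2
    e2 = sym (+-suc (length u) 1)

  -- Every letter of a word whose letters are below n is below n (at returns 0 off range).
  at-< : ∀ n v j → 1 ≤ n → All (_< n) v → at v j < n
  at-< n [] j h a = h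
  at-< n (x ∷ v) zero h a = h
  at-< n (x ∷ v) (suc zero) h (p ∷ a) = p
  at-< n (x ∷ v) (suc (suc j)) h (p ∷ a) = at-< n v (suc j) h a

  peakless-cons-max : ∀ n v → 1 ≤ n → All (_< n) v → peakless (n ∷ v) ≡ peakless v
  peakless-cons-max n v h a = ⇔⇒≡
      (λ e → PeakSet⇒hasPeakSet [] v (fwd (hasPeakSet⇒PeakSet [] (n ∷ v) e)))
      (λ e → PeakSet⇒hasPeakSet [] (n ∷ v) (bwd (hasPeakSet⇒PeakSet [] v e)))
    where
    fwd : PeakSet [] (n ∷ v) → PeakSet [] v
    fwd ps j with 2 ≤? j
    ... | no j<2 = ≢true⇒false (λ e → j<2 (proj₁ (peak-bounds v j e)))
    ... | yes j≥2 = trans (sym (isPeak-++-right (n ∷ []) v j j≥2)) (ps (suc j))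
    bwd : PeakSet [] v → PeakSet [] (n ∷ v)
    bwd ps zero = refl
    bwd ps (suc zero) = refl
    bwd ps (suc (suc zero)) = ≢true⇒false (λ e → <-asym (<ᵇ-sound n (at v 1) (peak-left (n ∷ v) 2 e)) (at-< n v 1 h a))
    bwd ps (suc (suc (suc j))) = trans (isPeak-++-right (n ∷ []) v (suc (suc j)) (s≤s (s≤s z≤n))) (ps (suc (suc j)))

  at-before-max : ∀ u n → 1 ≤ n → All (_< n) u → isPeak (u ++ n ∷ []) (length u) ≡ true
      → at (u ++ n ∷ []) (length u) < n
  at-before-max [] n h a ()
  at-before-max (x ∷ u) n h a e = subst (_< n)
      (sym (at-++l (x ∷ u) (n ∷ []) (length (x ∷ u)) (s≤s z≤n) ≤-refl))
      (at-< n (x ∷ u) (length (x ∷ u)) h a)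

  peakless-snoc-max : ∀ u n → 1 ≤ n → All (_< n) u → peakless (u ++ n ∷ []) ≡ peakless u
  peakless-snoc-max u n h a = ⇔⇒≡
      (λ e → PeakSet⇒hasPeakSet [] u (fwd (hasPeakSet⇒PeakSet [] (u ++ n ∷ []) e)))
      (λ e → PeakSet⇒hasPeakSet [] (u ++ n ∷ []) (bwd (hasPeakSet⇒PeakSet [] u e)))
    where
    w = u ++ n ∷ []
    lw : length w ≡ length u + 1
    lw = length-++ u
    fwd : PeakSet [] w → PeakSet [] u
    fwd ps i with i <? length u
    ... | yes lt = trans (sym (isPeak-++-left u (n ∷ []) i lt)) (ps i)
    ... | no nlt = ≢true⇒false (λ e → nlt (proj₂ (peak-bounds u i e)))
    bwd : PeakSet [] u → PeakSet [] w
    bwd ps i with <-cmp i (length u)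
    ... | tri< lt _ _ = trans (isPeak-++-left u (n ∷ []) i lt) (ps i)
    ... | tri≈ _ refl _ = ≢true⇒false
        (λ e → <-asym (<ᵇ-sound (at w (length u + 1)) (at w (length u)) (peak-right w (length u) e)) (subst (at w (length u) <_) (sym (at-++r u (n ∷ []) 0)) (at-before-max u n h a e)))
    ... | tri> _ _ gt = ≢true⇒false
        (λ e → <-irrefl refl (<-≤-trans (proj₂ (peak-bounds w i e)) (subst (_≤ i) (sym (trans lw (+-comm (length u) 1))) gt)))

  max-at-an-end : ∀ n pre post → distinct (pre ++ n ∷ post) ≡ true → peakless (pre ++ n ∷ post) ≡ true →
    All (_≤ n) (pre ++ n ∷ post) → 2 ≤ length (pre ++ n ∷ post) →
    1 ≡ χ (firstLetter (pre ++ n ∷ post) ≡ᵇ n) + χ (lastLetter (pre ++ n ∷ post) ≡ᵇ n)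
  max-at-an-end n [] [] d pl al (s≤s ())
  max-at-an-end n [] (b ∷ post) d pl al _
    rewrite ≡ᵇ-true {n} {n} refl
          | ≡ᵇ-false {lastLetter (b ∷ post)} {n} (∉⇒≢ {L = b ∷ post} (proj₂ (distinct-around [] n (b ∷ post) d)) (lastLetter-∈ b post)) = refl
  max-at-an-end n (a ∷ pre) [] d pl al _
    rewrite lastLetter-snoc (a ∷ pre) n | ≡ᵇ-true {n} {n} refl
          | ≡ᵇ-false {a} {n} (∉⇒≢ {L = a ∷ pre} (proj₁ (distinct-around (a ∷ pre) n [] d)) (here refl)) = refl
  max-at-an-end n (a ∷ pre) (b ∷ post) d pl al _ = ⊥-elim
      (true≢false (trans (sym (interior-max-peak a pre n b post l1 l2)) (hasPeakSet⇒PeakSet [] ((a ∷ pre) ++ n ∷ b ∷ post) pl (suc (length (a ∷ pre))))))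
    where
    ds = distinct-around (a ∷ pre) n (b ∷ post) d
    l1 : lastLetter (a ∷ pre) < n
    l1 = ≤∧≢⇒< (lookup al (∈-++⁺ˡ (lastLetter-∈ a pre))) (∉⇒≢ {L = a ∷ pre} (proj₁ ds) (lastLetter-∈ a pre))
    l2 : b < n
    l2 = ≤∧≢⇒< (lookup al (∈-++⁺ʳ (a ∷ pre) (there (here refl)))) (∉⇒≢ {L = b ∷ post} (proj₂ ds) (here refl))

  max-first-or-last : ∀ n w → 2 ≤ n → IsWord n (range n) w
      → χ (peaklessPerm w) ≡ χ (peaklessPerm w ∧ (firstLetter w ≡ᵇ n)) + χ (peaklessPerm w ∧ (lastLetter w ≡ᵇ n))
  max-first-or-last n w n≥2 (lw , aw) with peaklessPerm w in e
  ... | false = refl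
  ... | true with ∈-∃++ (elem⇒∈ n w (injective-word-uses-all n w (lw , aw) (∧-true-l e) (∈-range⁺ n (≤-trans (s≤s z≤n) n≥2) ≤-refl)))
  ... | pre , post , refl = max-at-an-end n pre post (∧-true-l e) (∧-true-r {distinct w} e)
      (All-map (λ x∈ → proj₂ (∈-range⁻ n x∈)) aw) (subst (2 ≤_) (sym lw) n≥2)

  peakless-avoiding-max : ∀ m
      → count (λ v → not (elem (suc m) v) ∧ peaklessPerm v) (words m (range (suc m))) ≡ peaklessCount m
  peakless-avoiding-max m = count-avoiding-peakSet (suc m) (suc m) m [] (s≤s z≤n) ≤-refl

  letters-below-max : ∀ n v → All (λ x → x ∈ range n) v → elem n v ≡ false → All (_< n) v
  letters-below-max n [] _ _ = []
  letters-below-max n (x ∷ v) (x∈ ∷ a) e = ≤∧≢⇒< (proj₂ (∈-range⁻ n x∈))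
      (∉⇒≢ {L = x ∷ v} e (here refl)) ∷ letters-below-max n v a (∨-false-r (n ≡ᵇ x) e)
    where
    ∨-false-r : ∀ b {c} → b ∨ c ≡ false → c ≡ false
    ∨-false-r false e = e

  count-max-first : ∀ m
      → count (λ w → peaklessPerm w ∧ (firstLetter w ≡ᵇ suc m)) (words (suc m) (range (suc m))) ≡ peaklessCount m
  count-max-first m =
    trans (count-words-suc _ m (range n))
    (trans (sumOver-single (range n) F (count-max n (s≤s z≤n)) zeroF)
    (trans (count-cong-words m (range n) pt) (peakless-avoiding-max m)))
    where
    n = suc m
    F : ℕ → ℕ
    F a = count (λ v → peaklessPerm (a ∷ v) ∧ (a ≡ᵇ n)) (words m (range n))
    zeroF : ∀ a → a ≢ n → F a ≡ 0
    zeroF a ne = trans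
        (count-cong (words m (range n)) (λ v → trans (cong (peaklessPerm (a ∷ v) ∧_) (≡ᵇ-false ne)) (∧-zeroʳ (peaklessPerm (a ∷ v)))))
        (count-false (words m (range n)))
    pt : ∀ v → IsWord m (range n) v → peaklessPerm (n ∷ v) ∧ (n ≡ᵇ n) ≡ not (elem n v) ∧ peaklessPerm v
    pt v (_ , av) rewrite ≡ᵇ-true {n} {n} refl | ∧-identityʳ (peaklessPerm (n ∷ v)) with elem n v in e
    ... | true = refl
    ... | false = cong (distinct v ∧_) (peakless-cons-max n v (s≤s z≤n) (letters-below-max n v av e))

  count-max-last : ∀ m
      → count (λ w → peaklessPerm w ∧ (lastLetter w ≡ᵇ suc m)) (words (suc m) (range (suc m))) ≡ peaklessCount m
  count-max-last m =
    trans (count-words-snoc _ m (range n))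
    (trans (sumOver-cong-words m (range n) pt) (peakless-avoiding-max m))
    where
    n = suc m
    snoc-max : ∀ u → All (λ x → x ∈ range n) u → peaklessPerm (u ++ n ∷ []) ≡ not (elem n u) ∧ peaklessPerm u
    snoc-max u au rewrite distinct-snoc u n with elem n u in e
    ... | true = refl
    ... | false = cong (distinct u ∧_) (peakless-snoc-max u n (s≤s z≤n) (letters-below-max n u au e))
    pt : ∀ u → IsWord m (range n) u
        → count (λ c → peaklessPerm (u ++ c ∷ []) ∧ (lastLetter (u ++ c ∷ []) ≡ᵇ n)) (range n) ≡ χ (not (elem n u) ∧ peaklessPerm u)
    pt u (_ , au) =
      trans (count-cong (range n) (λ c → cong (λ z → peaklessPerm (u ++ c ∷ []) ∧ (z ≡ᵇ n)) (lastLetter-snoc u c)))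
      (trans (sumOver-single (range n) (λ c → χ (peaklessPerm (u ++ c ∷ []) ∧ (c ≡ᵇ n))) (count-max n (s≤s z≤n))
                (λ a ne → trans (cong (λ z → χ (peaklessPerm (u ++ a ∷ []) ∧ z)) (≡ᵇ-false ne)) (cong χ (∧-zeroʳ (peaklessPerm (u ++ a ∷ []))))))
      (cong χ (trans (cong (peaklessPerm (u ++ n ∷ []) ∧_) (≡ᵇ-true {n} {n} refl)) (trans (∧-identityʳ _) (snoc-max u au)))))

  peaklessCount-double : ∀ m → 1 ≤ m → peaklessCount (suc m) ≡ peaklessCount m + peaklessCount m
  peaklessCount-double m h =
    trans (sumOver-cong-words (suc m) (range (suc m)) (λ w wi → max-first-or-last (suc m) w (s≤s h) wi))
    (trans (sumOver-+ W (λ w → χ (peaklessPerm w ∧ (firstLetter w ≡ᵇ suc m))) (λ w → χ (peaklessPerm w ∧ (lastLetter w ≡ᵇ suc m))))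
    (cong₂ _+_ (count-max-first m) (count-max-last m)))
    where W = words (suc m) (range (suc m))

  peaklessCount≡2^ : ∀ k → peaklessCount (suc k) ≡ 2 ^ k
  peaklessCount≡2^ zero = refl
  peaklessCount≡2^ (suc k) =
    trans (peaklessCount-double (suc k) (s≤s z≤n))
        (trans (cong₂ _+_ (peaklessCount≡2^ k) (peaklessCount≡2^ k)) (cong (2 ^ k +_) (sym (+-identityʳ (2 ^ k)))))

  maxL-ge : ∀ {x} S → x ∈ S → x ≤ maxL S
  maxL-ge (y ∷ S) (here refl) = m≤m⊔n y (maxL S)
  maxL-ge (y ∷ S) (there x∈) = ≤-trans (maxL-ge S x∈) (m≤n⊔m y (maxL S))

  maxL-∈ : ∀ x S → maxL (x ∷ S) ∈ (x ∷ S)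
  maxL-∈ x [] = here (⊔-identityʳ x)
  maxL-∈ x (y ∷ S) with ⊔-sel x (maxL (y ∷ S))
  ... | inj₁ e = here e
  ... | inj₂ e = there (subst (_∈ (y ∷ S)) (sym e) (maxL-∈ y S))

  maxL-< : ∀ S b → 1 ≤ b → (∀ {x} → x ∈ S → x < b) → maxL S < b
  maxL-< [] b 1≤b _ = 1≤b
  maxL-< (y ∷ S) b 1≤b below = ⊔-lub (below (here refl)) (maxL-< S b 1≤b (λ x∈ → below (there x∈)))

  delete : ℕ → List ℕ → List ℕ
  delete m S = filterᵇ (λ x → not (x ≡ᵇ m)) S

  ∈-filterᵇ⁻ : ∀ (q : ℕ → Bool) S {x} → x ∈ filterᵇ q S → (x ∈ S) × (q x ≡ true)
  ∈-filterᵇ⁻ q (y ∷ S) x∈ with q y in e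
  ∈-filterᵇ⁻ q (y ∷ S) (here refl) | true = here refl , e
  ∈-filterᵇ⁻ q (y ∷ S) (there x∈) | true = there (proj₁ (∈-filterᵇ⁻ q S x∈)) , proj₂ (∈-filterᵇ⁻ q S x∈)
  ∈-filterᵇ⁻ q (y ∷ S) x∈ | false = there (proj₁ (∈-filterᵇ⁻ q S x∈)) , proj₂ (∈-filterᵇ⁻ q S x∈)

  elem-delete : ∀ m i S → elem i (delete m S) ≡ elem i S ∧ not (i ≡ᵇ m)
  elem-delete m i [] = refl
  elem-delete m i (y ∷ S) with y ≟ m
  elem-delete m i (y ∷ S) | yes refl rewrite ≡ᵇ-true {y} {y} refl | elem-delete y i S with i ≟ y
  ... | yes refl rewrite ≡ᵇ-true {i} {i} refl = ∧-zeroʳ (elem i S)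
  ... | no i≢y rewrite ≡ᵇ-false i≢y = refl
  elem-delete m i (y ∷ S) | no y≢m rewrite ≡ᵇ-false y≢m | elem-delete m i S with i ≟ y
  ... | yes refl rewrite ≡ᵇ-true {i} {i} refl | ≡ᵇ-false y≢m = refl
  ... | no i≢y rewrite ≡ᵇ-false i≢y = refl

  insert-deleted : ∀ m S → m ∈ S → ∀ i → elem i (m ∷ delete m S) ≡ elem i S
  insert-deleted m S m∈ i with i ≟ m
  ... | yes refl rewrite ≡ᵇ-true {i} {i} refl = sym (∈⇒elem S m∈)
  ... | no i≢m rewrite elem-delete m i S | ≡ᵇ-false i≢m = ∧-identityʳ (elem i S)

  delete-top-below : ∀ p S → (∀ {x} → x ∈ S → x ≤ suc p) → elem p S ≡ false → ∀ {x} → x ∈ delete (suc p) S → x < p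
  delete-top-below p S bound p∉S x∈ with ∈-filterᵇ⁻ (λ x → not (x ≡ᵇ suc p)) S x∈
  ... | x∈S , x≢top = ≤∧≢⇒< (≤-pred (≤∧≢⇒< (bound x∈S) x≢suc-p)) x≢p
    where
    x≢suc-p : _ ≢ suc p
    x≢suc-p e = true≢false (trans (sym (≡ᵇ-true e)) (trans (sym (not-involutive _)) (cong not x≢top)))
    x≢p : _ ≢ p
    x≢p refl = true≢false (trans (sym (∈⇒elem S x∈S)) p∉S)

  peak-recurrence-top : ∀ p S → suc p ∈ S → (∀ {x} → x ∈ S → x ≤ suc p) → elem p S ≡ false → ∀ k →
    binom (p + k) p * countPeaks (delete (suc p) S) p * peaklessCount k
      ≡ countPeaks (delete (suc p) S) (p + k) + countPeaks (p ∷ delete (suc p) S) (p + k) + countPeaks S (p + k)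
  peak-recurrence-top p S top∈ bound p∉S k =
    trans (peak-recurrence p k S₁ above-p-absent)
          (cong (countPeaks S₁ (p + k) + countPeaks (p ∷ S₁) (p + k) +_)
                (count-cong (words (p + k) (range (p + k)))
                            (λ w → cong (distinct w ∧_) (hasPeakSet-cong (suc p ∷ S₁) S w (insert-deleted (suc p) S top∈)))))
    where
    S₁ = delete (suc p) S
    above-p-absent : ∀ i → p ≤ i → elem i S₁ ≡ false
    above-p-absent i p≤i = ≢true⇒false (λ e → <⇒≱ (delete-top-below p S bound p∉S (elem⇒∈ i S₁ e)) p≤i)

  countPeaks-impossible : ∀ S n → (∀ w → hasPeakSet S w ≡ true → ⊥) → countPeaks S n ≡ 0
  countPeaks-impossible S n impossible =
    trans
        (count-cong (words n (range n)) (λ w → ≢true⇒false (λ e → impossible w (∧-true-r {distinct w} e))))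
        (count-false (words n (range n)))

  small-peak-impossible : ∀ S {x} → x ∈ S → x < 2 → ∀ w → hasPeakSet S w ≡ true → ⊥
  small-peak-impossible S {x} x∈ x<2 w e = <⇒≱ x<2
      (proj₁ (peak-bounds w x (trans (hasPeakSet⇒PeakSet S w e x) (∈⇒elem S x∈))))

  adjacent-peaks-impossible : ∀ S p → p ∈ S → suc p ∈ S → ∀ w → hasPeakSet S w ≡ true → ⊥
  adjacent-peaks-impossible S p p∈ sp∈ w e =
    true≢false
        (trans (sym (trans (hasPeakSet⇒PeakSet S w e (suc p)) (∈⇒elem S sp∈))) (peaks-not-adjacent w p (trans (hasPeakSet⇒PeakSet S w e p) (∈⇒elem S p∈))))

  countPeaks-short : ∀ S {m} → m ∈ S → ∀ k → k ≤ m → countPeaks S k ≡ 0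
  countPeaks-short S {m} m∈ k k≤m =
    trans
        (count-cong-words k (range k) (λ w wi → ≢true⇒false (λ e → <⇒≱ (subst (m <_) (proj₁ wi) (peak-before-end w e)) k≤m)))
          (count-false (words k (range k)))
    where
    peak-before-end : ∀ w → distinct w ∧ hasPeakSet S w ≡ true → m < length w
    peak-before-end w e = proj₂
        (peak-bounds w m (trans (hasPeakSet⇒PeakSet S w (∧-true-r {distinct w} e) m) (∈⇒elem S m∈)))

  small-element? : ∀ S → (∃ λ x → x ∈ S × x < 2) ⊎ (∀ {x} → x ∈ S → 2 ≤ x)
  small-element? [] = inj₂ (λ ())
  small-element? (y ∷ S) with y <? 2 | small-element? S
  ... | yes y<2 | _ = inj₁ (y , here refl , y<2)
  ... | no _ | inj₁ (x , x∈ , x<2) = inj₁ (x , there x∈ , x<2)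
  ... | no y≮2 | inj₂ large = inj₂ λ { (here refl) → ≮⇒≥ y≮2 ; (there x∈) → large x∈ }

module Recurrence where

  open Combinatorics
  open import Data.Bool using (true; false)
  open import Data.Nat as N using (ℕ; zero; suc; _∸_; _≤_; _<_; z≤n; s≤s; _≤ᵇ_; _<ᵇ_; _⊔_)
  import Data.Nat.Properties as NP
  open import Data.Nat.Combinatorics using (_C_)
  open import Data.Integer as ℤ using (ℤ; +_; _+_; _*_; -_; 0ℤ; 1ℤ; _^_; ∣_∣)
  open import Data.Integer.Properties using (pos-+; pos-*; i*j≡0⇒i≡0∨j≡0; *-zeroˡ; *-zeroʳ; *-identityˡ; +-identityʳ; +-assoc; *-distribˡ-+; +-commutativeSemigroup)
  open import Algebra.Properties.CommutativeSemigroup +-commutativeSemigroup using (interchange)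
  open import Data.List using (List; []; _∷_)
  open import Data.List.Membership.Propositional using (_∈_)
  open import Data.List.Relation.Unary.Any using (here; there)
  open import Relation.Binary.PropositionalEquality
  open import Data.Product using (_,_)
  open import Data.Sum using (inj₁; inj₂)
  open import Data.Empty using (⊥; ⊥-elim)

  -- L₂ k f n = ((1 - 2E)^k f)(n) = Σ_{j ≤ k} (-2)^j C(k,j) f(n-j), where E f (n) = f (n-1).
  minusTwo : ℤ
  minusTwo = - (+ 2)

  L₂ : ℕ → (ℕ → ℤ) → ℕ → ℤ
  L₂ k f n = sumTo k (λ j → minusTwo ^ j * + binom k j * f (n ∸ j))

  sumTo-cong : ∀ k {f g : ℕ → ℤ} → (∀ j → j N.≤ k → f j ≡ g j) → sumTo k f ≡ sumTo k g
  sumTo-cong zero e = e 0 z≤n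
  sumTo-cong (suc k) e = cong₂ _+_ (sumTo-cong k (λ j j≤ → e j (NP.≤-trans j≤ (NP.n≤1+n k)))) (e (suc k) NP.≤-refl)

  sumTo-zero : ∀ k (f : ℕ → ℤ) → (∀ j → j ≤ k → f j ≡ 0ℤ) → sumTo k f ≡ 0ℤ
  sumTo-zero zero f f≡0 = f≡0 0 z≤n
  sumTo-zero (suc k) f f≡0 = cong₂ _+_ (sumTo-zero k f (λ j j≤k → f≡0 j (NP.m≤n⇒m≤1+n j≤k))) (f≡0 (suc k) NP.≤-refl)

  sumTo-+ : ∀ k (f g : ℕ → ℤ) → sumTo k (λ j → f j + g j) ≡ sumTo k f + sumTo k g
  sumTo-+ zero f g = refl
  sumTo-+ (suc k) f g = trans (cong (_+ (f (suc k) + g (suc k))) (sumTo-+ k f g))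
      (interchange (sumTo k f) (sumTo k g) (f (suc k)) (g (suc k)))

  sumTo-* : ∀ k (c : ℤ) (f : ℕ → ℤ) → sumTo k (λ j → c * f j) ≡ c * sumTo k f
  sumTo-* zero c f = refl
  sumTo-* (suc k) c f = trans (cong (_+ c * f (suc k)) (sumTo-* k c f)) (sym (*-distribˡ-+ c (sumTo k f) (f (suc k))))

  sumTo-shift : ∀ k (f : ℕ → ℤ) → sumTo (suc k) f ≡ f 0 + sumTo k (λ i → f (suc i))
  sumTo-shift zero f = refl
  sumTo-shift (suc k) f = trans (cong (_+ f (suc (suc k))) (sumTo-shift k f)) (+-assoc (f 0) _ _)

  sumTo-trunc : ∀ a n (F : ℕ → ℤ) → a ≤ n → (∀ i → a < i → i ≤ n → F i ≡ 0ℤ) → sumTo n F ≡ sumTo a F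
  sumTo-trunc a n F a≤n vanish with NP.m≤n⇒m<n∨m≡n a≤n
  ... | inj₂ refl = refl
  ... | inj₁ a<n with n
  ... | suc n' = trans
      (cong₂ _+_ (sumTo-trunc a n' F (NP.≤-pred a<n) (λ i a<i i≤n' → vanish i a<i (NP.m≤n⇒m≤1+n i≤n'))) (vanish (suc n') a<n NP.≤-refl))
                       (+-identityʳ (sumTo a F))

  ∸-suc : ∀ n i → n ∸ suc i ≡ (n ∸ 1) ∸ i
  ∸-suc zero i = sym (NP.0∸n≡0 i)
  ∸-suc (suc n) i = refl

  L₂-suc : ∀ k f n → L₂ (suc k) f n ≡ L₂ k f n + minusTwo * L₂ k f (n ∸ 1)
  L₂-suc k f n =
    begin
      sumTo (suc k) upper
    ≡⟨ sumTo-shift k upper ⟩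
      upper 0 + sumTo k (λ i → upper (suc i))
    ≡⟨ cong (λ z → upper 0 + z) (trans (sumTo-cong k (λ i _ → pascal-term i)) (sumTo-+ k (λ i → minusTwo * shifted i) (λ i → lower (suc i)))) ⟩
      upper 0 + (sumTo k (λ i → minusTwo * shifted i) + sumTo k (λ i → lower (suc i)))
    ≡⟨ cong (λ z → upper 0 + (z + sumTo k (λ i → lower (suc i)))) (sumTo-* k minusTwo shifted) ⟩
      upper 0 + (minusTwo * L₂ k f (n ∸ 1) + sumTo k (λ i → lower (suc i)))
    ≡⟨ rearrange (upper 0) (minusTwo * L₂ k f (n ∸ 1)) (sumTo k (λ i → lower (suc i))) ⟩
      (lower 0 + sumTo k (λ i → lower (suc i))) + minusTwo * L₂ k f (n ∸ 1)
    ≡⟨ cong (_+ minusTwo * L₂ k f (n ∸ 1)) (sym (sumTo-shift k lower)) ⟩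
      (sumTo k lower + lower (suc k)) + minusTwo * L₂ k f (n ∸ 1)
    ≡⟨ cong (λ z → z + minusTwo * L₂ k f (n ∸ 1)) (trans (cong (λ z → sumTo k lower + z) last-vanishes) (+-identityʳ (sumTo k lower))) ⟩
      L₂ k f n + minusTwo * L₂ k f (n ∸ 1)
    ∎
    where
    open ≡-Reasoning
    open import Data.Integer.Tactic.RingSolver
    upper lower shifted : ℕ → ℤ
    upper j = minusTwo ^ j * + binom (suc k) j * f (n ∸ j)
    lower j = minusTwo ^ j * + binom k j * f (n ∸ j)
    shifted i = minusTwo ^ i * + binom k i * f ((n ∸ 1) ∸ i)
    distribute : ∀ x y z F → (minusTwo * x) * (y + z) * F ≡ minusTwo * (x * y * F) + (minusTwo * x) * z * F
    distribute = solve-∀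
    pascal-term : ∀ i → upper (suc i) ≡ minusTwo * shifted i + lower (suc i)
    pascal-term i = trans
        (cong (λ z → (minusTwo * minusTwo ^ i) * z * f (n ∸ suc i)) (pos-+ (binom k i) (binom k (suc i))))
                    (trans (distribute (minusTwo ^ i) (+ binom k i) (+ binom k (suc i)) (f (n ∸ suc i)))
                    (cong (λ z → minusTwo * (minusTwo ^ i * + binom k i * f z) + lower (suc i)) (∸-suc n i)))
    rearrange : ∀ a b c → a + (b + c) ≡ (a + c) + b
    rearrange = solve-∀
    last-vanishes : lower (suc k) ≡ 0ℤ
    last-vanishes = trans (cong (λ z → minusTwo ^ suc k * + z * f (n ∸ suc k)) (binom-zero k (suc k) (NP.n<1+n k)))
                          (trans (cong (_* f (n ∸ suc k)) (*-zeroʳ (minusTwo ^ suc k))) (*-zeroˡ (f (n ∸ suc k))))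

  L₂-cong : ∀ k n {f g : ℕ → ℤ} → (∀ j → j N.≤ k → f (n ∸ j) ≡ g (n ∸ j)) → L₂ k f n ≡ L₂ k g n
  L₂-cong k n e = sumTo-cong k (λ j j≤ → cong (minusTwo ^ j * + binom k j *_) (e j j≤))

  L₂-+ : ∀ k n (f g : ℕ → ℤ) → L₂ k (λ m → f m + g m) n ≡ L₂ k f n + L₂ k g n
  L₂-+ k n f g = trans
      (sumTo-cong k (λ j _ → *-distribˡ-+ (minusTwo ^ j * + binom k j) (f (n ∸ j)) (g (n ∸ j))))
      (sumTo-+ k _ _)

  L₂-* : ∀ k n (c : ℤ) (f : ℕ → ℤ) → L₂ k (λ m → c * f m) n ≡ c * L₂ k f n
  L₂-* k n c f = trans (sumTo-cong k (λ j _ → d (minusTwo ^ j * + binom k j) c (f (n ∸ j))))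
      (sumTo-* k c (λ j → minusTwo ^ j * + binom k j * f (n ∸ j)))
    where
    open import Data.Integer.Tactic.RingSolver
    d : ∀ a c x → a * (c * x) ≡ c * (a * x)
    d = solve-∀

  L₂-shift : ∀ k n (f : ℕ → ℤ) → L₂ k (λ m → f (m ∸ 1)) n ≡ L₂ k f (n ∸ 1)
  L₂-shift k n f = sumTo-cong k (λ j _ → cong (λ z → minusTwo ^ j * + binom k j * f z)
    (trans (NP.∸-+-assoc n j 1) (trans (cong (n ∸_) (NP.+-comm j 1)) (sym (NP.∸-+-assoc n 1 j)))))

  Δ : (ℕ → ℤ) → ℕ → ℤ
  Δ f m = f m + minusTwo * f (m ∸ 1)

  L₂-suc-Δ : ∀ k f n → L₂ (suc k) f n ≡ L₂ k (Δ f) n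
  L₂-suc-Δ k f n = trans (L₂-suc k f n)
      (sym (trans (L₂-+ k n f (λ m → minusTwo * f (m ∸ 1))) (cong (λ z → L₂ k f n + z) (trans (L₂-* k n minusTwo (λ m → f (m ∸ 1))) (cong (minusTwo *_) (L₂-shift k n f))))))

  L₂-zero : ∀ f n → L₂ 0 f n ≡ f n
  L₂-zero f n = *-identityˡ (f n)

  Annihilates : ℕ → (ℕ → ℤ) → ℕ → Set
  Annihilates k f N = ∀ n → N N.+ k N.≤ n → L₂ k f n ≡ 0ℤ

  Annihilates-suc : ∀ k f N → Annihilates k f N → Annihilates (suc k) f N
  Annihilates-suc k f N a n le =
    trans (L₂-suc k f n) (trans (cong₂ (λ x y → x + minusTwo * y) (a n (NP.≤-trans (NP.+-monoʳ-≤ N (NP.n≤1+n k)) le))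
       (a (n ∸ 1) (NP.≤-trans (NP.≤-reflexive (sym (NP.m+n∸n≡m (N N.+ k) 1))) (NP.∸-monoˡ-≤ 1 (NP.≤-trans (NP.≤-reflexive (trans (NP.+-assoc N k 1) (cong (N N.+_) (NP.+-comm k 1)))) le)))))
       refl)

  Annihilates-mono : ∀ k k' f N N' → Annihilates k f N → k N.≤ k' → N N.≤ N' → Annihilates k' f N'
  Annihilates-mono k k' f N N' a k≤ N≤ = go k' k≤
    where
    go : ∀ k' → k N.≤ k' → Annihilates k' f N'
    go k' k≤' with NP.m≤n⇒m<n∨m≡n k≤'
    ... | inj₂ refl = λ n le → a n (NP.≤-trans (NP.+-monoˡ-≤ k N≤) le)
    ... | inj₁ lt with k'
    ... | suc k'' = Annihilates-suc k'' f N' (go k'' (NP.≤-pred lt))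

  Annihilates-cong : ∀ k f g N → (∀ n → N N.≤ n → f n ≡ g n) → Annihilates k g N → Annihilates k f N
  Annihilates-cong k f g N e a n le = trans (L₂-cong k n {f} {g} (λ j j≤ → e (n ∸ j) (ge j j≤))) (a n le)
    where
    ge : ∀ j → j N.≤ k → N N.≤ n ∸ j
    ge j j≤ = NP.≤-trans (NP.≤-reflexive (sym (NP.m+n∸n≡m N k))) (NP.≤-trans (NP.∸-monoˡ-≤ k le) (NP.∸-monoʳ-≤ n j≤))

  Annihilates-linear : ∀ k f g N (a b : ℤ) → Annihilates k f N → Annihilates k g N
      → Annihilates k (λ n → a * f n + b * g n) N
  Annihilates-linear k f g N a b ann-f ann-g n le =
    trans (L₂-+ k n (λ m → a * f m) (λ m → b * g m))
    (trans (cong₂ _+_ (trans (L₂-* k n a f) (cong (a *_) (ann-f n le))) (trans (L₂-* k n b g) (cong (b *_) (ann-g n le))))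
    (cong₂ _+_ (*-zeroʳ a) (*-zeroʳ b)))

  Annihilates-zero : ∀ k f N → (∀ n → f n ≡ 0ℤ) → Annihilates k f N
  Annihilates-zero k f N f≡0 n _ = sumTo-zero k (λ j → minusTwo ^ j * + binom k j * f (n ∸ j))
      (λ j _ → trans (cong (minusTwo ^ j * + binom k j *_) (f≡0 (n ∸ j))) (*-zeroʳ (minusTwo ^ j * + binom k j)))

  binomPow2 : ℕ → ℕ → ℤ
  binomPow2 p n = + (binom n p N.* 2 N.^ n)

  Δ-binomPow2-zero : ∀ m → Δ (binomPow2 0) (suc m) ≡ 0ℤ
  Δ-binomPow2-zero m = trans
      (cong₂ (λ x y → x + minusTwo * y) (trans (cong +_ (NP.*-identityˡ (2 N.* 2 N.^ m))) (pos-* 2 (2 N.^ m))) (cong +_ (NP.*-identityˡ (2 N.^ m))))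
      (z (+ (2 N.^ m)))
    where
    open import Data.Integer.Tactic.RingSolver
    z : ∀ x → + 2 * x + minusTwo * x ≡ 0ℤ
    z = solve-∀

  Δ-binomPow2-suc : ∀ q m → Δ (binomPow2 (suc q)) (suc m) ≡ + 2 * binomPow2 q m
  Δ-binomPow2-suc q m =
    trans (cong₂ (λ x y → x + minusTwo * y)
            (trans (pos-* (binom m q N.+ binom m (suc q)) (2 N.* 2 N.^ m)) (cong₂ _*_ (pos-+ (binom m q) (binom m (suc q))) (pos-* 2 (2 N.^ m))))
            (pos-* (binom m (suc q)) (2 N.^ m)))
    (trans (z (+ binom m q) (+ binom m (suc q)) (+ (2 N.^ m))) (cong (+ 2 *_) (sym (pos-* (binom m q) (2 N.^ m)))))
    where
    open import Data.Integer.Tactic.RingSolver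
    z : ∀ a b X → (a + b) * (+ 2 * X) + minusTwo * (b * X) ≡ + 2 * (a * X)
    z = solve-∀

  binomPow2-annihilated : ∀ p n → suc p N.≤ n → L₂ (suc p) (binomPow2 p) n ≡ 0ℤ
  binomPow2-annihilated zero (suc m) _ = trans (L₂-suc-Δ 0 (binomPow2 0) (suc m))
      (trans (L₂-zero (Δ (binomPow2 0)) (suc m)) (Δ-binomPow2-zero m))
  binomPow2-annihilated (suc q) n le =
    trans (L₂-suc-Δ (suc q) (binomPow2 (suc q)) n)
    (trans (L₂-cong (suc q) n {Δ (binomPow2 (suc q))} {λ m → + 2 * binomPow2 q (m ∸ 1)} (λ j j≤ → pt (n ∸ j) (pos j j≤)))
    (trans (L₂-* (suc q) n (+ 2) (λ m → binomPow2 q (m ∸ 1)))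
    (trans (cong (+ 2 *_) (trans (L₂-shift (suc q) n (binomPow2 q)) (binomPow2-annihilated q (n ∸ 1) (NP.≤-trans (NP.≤-reflexive refl) (NP.∸-monoˡ-≤ 1 le)))))
    (*-zeroʳ (+ 2)))))
    where
    pt : ∀ x → 1 N.≤ x → Δ (binomPow2 (suc q)) x ≡ + 2 * binomPow2 q (x ∸ 1)
    pt (suc x) _ = Δ-binomPow2-suc q x
    pos : ∀ j → j N.≤ suc q → 1 N.≤ n ∸ j
    pos j j≤ = NP.≤-trans (NP.≤-reflexive (sym (NP.m+n∸n≡m 1 (suc q))))
        (NP.≤-trans (NP.∸-monoˡ-≤ (suc q) le) (NP.∸-monoʳ-≤ n j≤))

  2^k≢0 : ∀ k → + (2 N.^ k) ≡ 0ℤ → ⊥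
  2^k≢0 k eq = NP.<⇒≢ (NP.m^n>0 2 k) (sym (cong ∣_∣ eq))

  -- The main term of the peak recurrence, C(n,p) c G(n-p) with G(k+1) = 2^k, is a
  -- multiple of C(n,p) 2^n from n = p+1 on; as ℤ has no zero divisors it is annihilated.
  binomTerm-annihilated : ∀ p c (G : ℕ → ℕ) → (∀ k → G (suc k) ≡ 2 N.^ k)
      → Annihilates (suc p) (λ n → + (binom n p N.* c N.* G (n ∸ p))) (suc p)
  binomTerm-annihilated p c G G≡2^ n le with i*j≡0⇒i≡0∨j≡0 (+ (2 N.^ suc p)) scaled
    where
    term : ℕ → ℤ
    term n = + (binom n p N.* c N.* G (n ∸ p))
    2^p+1 = + (2 N.^ suc p)
    term-shifted : ∀ d → 2^p+1 * term (suc p N.+ d) ≡ + c * binomPow2 p (suc p N.+ d)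
    term-shifted d = trans (sym (pos-* (2 N.^ suc p) _))
                     (trans (cong (λ z → + (2 N.^ suc p N.* (binom (suc p N.+ d) p N.* c N.* G z))) (trans (cong (_∸ p) (sym (NP.+-suc p d))) (NP.m+n∸m≡n p (suc d))))
                     (trans (cong (λ z → + (2 N.^ suc p N.* (binom (suc p N.+ d) p N.* c N.* z))) (G≡2^ d))
                     (trans (cong +_ (rearrange (binom (suc p N.+ d) p) c (2 N.^ d) (2 N.^ suc p)))
                     (trans (cong (λ z → + (c N.* (binom (suc p N.+ d) p N.* z))) (sym (NP.^-distribˡ-+-* 2 (suc p) d)))
                     (pos-* c _)))))
      where
      open import Data.Nat.Tactic.RingSolver
      rearrange : ∀ A C D Q → Q N.* (A N.* C N.* D) ≡ C N.* (A N.* (Q N.* D))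
      rearrange = solve-∀
    term-scaled : ∀ x → suc p N.≤ x → 2^p+1 * term x ≡ + c * binomPow2 p x
    term-scaled x x≥ = subst (λ x → 2^p+1 * term x ≡ + c * binomPow2 p x) (NP.m+[n∸m]≡n x≥) (term-shifted (x ∸ suc p))
    scaled : 2^p+1 * L₂ (suc p) term n ≡ 0ℤ
    scaled = trans (sym (L₂-* (suc p) n 2^p+1 term))
             (trans (L₂-cong (suc p) n {λ m → 2^p+1 * term m} {λ m → + c * binomPow2 p m} (λ j j≤ → term-scaled (n ∸ j) (late j j≤)))
             (trans (L₂-* (suc p) n (+ c) (binomPow2 p)) (trans (cong (+ c *_) (binomPow2-annihilated p n (NP.≤-trans (NP.m≤n+m (suc p) (suc p)) le))) (*-zeroʳ (+ c)))))
      where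
      late : ∀ j → j N.≤ suc p → suc p N.≤ n ∸ j
      late j j≤ = NP.≤-trans (NP.≤-reflexive (sym (NP.m+n∸n≡m (suc p) (suc p))))
          (NP.≤-trans (NP.∸-monoˡ-≤ (suc p) le) (NP.∸-monoʳ-≤ n j≤))
  ... | inj₁ eq = ⊥-elim (2^k≢0 (suc p) eq)
  ... | inj₂ eq = eq

  peaklessCount-annihilated : Annihilates 1 (λ n → + peaklessCount n) 1
  peaklessCount-annihilated zero ()
  peaklessCount-annihilated (suc zero) (s≤s ())
  peaklessCount-annihilated (suc (suc k)) _ =
    trans (L₂-suc-Δ 0 (λ n → + peaklessCount n) (suc (suc k)))
    (trans (L₂-zero (Δ (λ n → + peaklessCount n)) (suc (suc k)))
    (trans (cong (λ z → + z + minusTwo * + peaklessCount (suc k)) (peaklessCount-double (suc k) (s≤s z≤n)))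
    (trans (cong (λ z → z + minusTwo * + peaklessCount (suc k)) (pos-+ (peaklessCount (suc k)) (peaklessCount (suc k)))) (z (+ peaklessCount (suc k))))))
    where
    open import Data.Integer.Tactic.RingSolver
    z : ∀ a → a + a + minusTwo * a ≡ 0ℤ
    z = solve-∀

  countℤ : List ℕ → ℕ → ℤ
  countℤ S n = + countPeaks S n

  countℤ-impossible : ∀ S → (∀ w → hasPeakSet S w ≡ true → ⊥) → ∀ n → countℤ S n ≡ 0ℤ
  countℤ-impossible S impossible n = cong +_ (countPeaks-impossible S n impossible)

  order : List ℕ → ℕ
  order S = maxL S ⊔ 1

  order-≤ : ∀ S m → (∀ {x} → x ∈ S → x < m) → 1 ≤ m → order S ≤ m
  order-≤ S m below 1≤m = NP.⊔-lub (NP.<⇒≤ (maxL-< S m 1≤m below)) 1≤m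

  -- Inductive step for S with maximum p+1 and p ∉ S: by the peak recurrence,
  --   #P(S;n) = C(n,p) #P(S₁;p) 2^(n-p-1) - #P(S₁;n) - #P(S₁ ∪ {p};n)   (n ≥ p+1),
  -- so #P(S;·) is annihilated at order p+1 once the counts for S₁ and S₁ ∪ {p} are.
  annihilation-step : ∀ p S → suc p ∈ S → (∀ {x} → x ∈ S → x ≤ suc p) → elem p S ≡ false →
    Annihilates (suc p) (countℤ (delete (suc p) S)) (suc p) →
    Annihilates (suc p) (countℤ (p ∷ delete (suc p) S)) (suc p) →
    Annihilates (suc p) (countℤ S) (suc p)
  annihilation-step p S top∈ bound p∉S ann₁ ann₂ =
    Annihilates-cong (suc p) (countℤ S) combination (suc p) recurrence
      (Annihilates-linear (suc p) main (λ n → 1ℤ * countℤ S₁ n + 1ℤ * countℤ T₂ n) (suc p) 1ℤ (- 1ℤ)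
        (binomTerm-annihilated p (countPeaks S₁ p) peaklessCount peaklessCount≡2^)
        (Annihilates-linear (suc p) (countℤ S₁) (countℤ T₂) (suc p) 1ℤ 1ℤ ann₁ ann₂))
    where
    S₁ = delete (suc p) S
    T₂ = p ∷ S₁
    main : ℕ → ℤ
    main n = + (binom n p N.* countPeaks S₁ p N.* peaklessCount (n ∸ p))
    combination : ℕ → ℤ
    combination n = 1ℤ * main n + (- 1ℤ) * (1ℤ * countℤ S₁ n + 1ℤ * countℤ T₂ n)
    cancel : ∀ a b s → 1ℤ * (a + b + s) + (- 1ℤ) * (1ℤ * a + 1ℤ * b) ≡ s
    cancel = solve-∀
      where open import Data.Integer.Tactic.RingSolver
    main≡ : ∀ k → main (p N.+ k) ≡ countℤ S₁ (p N.+ k) + countℤ T₂ (p N.+ k) + countℤ S (p N.+ k)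
    main≡ k =
      begin
        + (binom (p N.+ k) p N.* countPeaks S₁ p N.* peaklessCount (p N.+ k ∸ p))
      ≡⟨ cong (λ z → + (binom (p N.+ k) p N.* countPeaks S₁ p N.* peaklessCount z)) (NP.m+n∸m≡n p k) ⟩
        + (binom (p N.+ k) p N.* countPeaks S₁ p N.* peaklessCount k)
      ≡⟨ cong +_ (peak-recurrence-top p S top∈ bound p∉S k) ⟩
        + (countPeaks S₁ (p N.+ k) N.+ countPeaks T₂ (p N.+ k) N.+ countPeaks S (p N.+ k))
      ≡⟨ trans (pos-+ _ (countPeaks S (p N.+ k))) (cong (_+ countℤ S (p N.+ k)) (pos-+ (countPeaks S₁ (p N.+ k)) _)) ⟩
        countℤ S₁ (p N.+ k) + countℤ T₂ (p N.+ k) + countℤ S (p N.+ k)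
      ∎
      where open ≡-Reasoning
    recurrence : ∀ n → suc p ≤ n → countℤ S n ≡ combination n
    recurrence n sp≤n = subst (λ z → countℤ S z ≡ combination z)
        (NP.m+[n∸m]≡n (NP.≤-trans (NP.n≤1+n p) sp≤n)) (shifted (n ∸ p))
      where
      shifted : ∀ k → countℤ S (p N.+ k) ≡ combination (p N.+ k)
      shifted k = sym
          (trans (cong (λ z → 1ℤ * z + (- 1ℤ) * (1ℤ * countℤ S₁ (p N.+ k) + 1ℤ * countℤ T₂ (p N.+ k))) (main≡ k))
                        (cancel (countℤ S₁ (p N.+ k)) (countℤ T₂ (p N.+ k)) (countℤ S (p N.+ k))))

  -- For S with maximum p+1: if p ∈ S too, S is never a peak set; otherwise apply the
  -- inductive step, the sets S₁ and S₁ ∪ {p} having all their elements below p+1.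
  annihilated-top : ∀ p S → suc p ∈ S → (∀ {x} → x ∈ S → x ≤ suc p) →
    (∀ T → (∀ {x} → x ∈ T → x < suc p) → Annihilates (order T) (countℤ T) (order T)) →
    Annihilates (suc p) (countℤ S) (suc p)
  annihilated-top p S top∈ bound ih with elem p S in p∈?
  ... | true = Annihilates-zero (suc p) (countℤ S) (suc p)
      (countℤ-impossible S (adjacent-peaks-impossible S p (elem⇒∈ p S p∈?) top∈))
  ... | false = annihilation-step p S top∈ bound p∈? (lift S₁ S₁-below) (lift (p ∷ S₁) T₂-below)
    where
    S₁ = delete (suc p) S
    S₁-below : ∀ {x} → x ∈ S₁ → x < suc p
    S₁-below x∈ = NP.m<n⇒m<1+n (delete-top-below p S bound p∈? x∈)
    T₂-below : ∀ {x} → x ∈ p ∷ S₁ → x < suc p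
    T₂-below (here refl) = NP.n<1+n p
    T₂-below (there x∈) = S₁-below x∈
    lift : ∀ T → (∀ {x} → x ∈ T → x < suc p) → Annihilates (suc p) (countℤ T) (suc p)
    lift T below = Annihilates-mono (order T) (suc p) (countℤ T) (order T) (suc p) (ih T below) order≤ order≤
      where order≤ = order-≤ T (suc p) below (s≤s z≤n)

  -- Strong induction on a bound for max S.  Sets with an element below 2 are never peak
  -- sets, S = ∅ counts the peakless permutations, and otherwise max S ≥ 2.
  annihilated-below : ∀ b S → maxL S < b → Annihilates (order S) (countℤ S) (order S)
  annihilated-below zero S ()
  annihilated-below (suc b) S max<b with small-element? S
  ... | inj₁ (x , x∈ , x<2) = Annihilates-zero (order S) (countℤ S) (order S)
      (countℤ-impossible S (small-peak-impossible S x∈ x<2))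
  annihilated-below (suc b) [] _ | inj₂ _ = peaklessCount-annihilated
  annihilated-below (suc b) (y ∷ S') max<b | inj₂ large =
    subst (λ k → Annihilates k (countℤ S) k) (sym order≡)
      (annihilated-top p S (subst (_∈ S) m≡ (maxL-∈ y S')) (λ {x} x∈ → subst (x ≤_) m≡ (maxL-ge S x∈))
        (λ T below → annihilated-below b T (NP.<-≤-trans (maxL-< T (suc p) (s≤s z≤n) below) (subst (_≤ b) m≡ (NP.≤-pred max<b)))))
    where
    S = y ∷ S'
    p = maxL S ∸ 1
    1≤m : 1 ≤ maxL S
    1≤m = NP.≤-trans (s≤s z≤n) (large (maxL-∈ y S'))
    m≡ : maxL S ≡ suc p
    m≡ = sym (NP.m+[n∸m]≡n 1≤m)
    order≡ : order S ≡ suc p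
    order≡ = trans (NP.m≥n⇒m⊔n≡m 1≤m) m≡

  peakCount-annihilated : ∀ S → Annihilates (order S) (countℤ S) (order S)
  peakCount-annihilated S = annihilated-below (suc (maxL S)) S (NP.n<1+n (maxL S))

  powS-coefficient : ∀ m k → powS oneMinus2x m k ≡ minusTwo ^ k * + binom m k
  powS-coefficient zero zero = refl
  powS-coefficient zero (suc k) = sym (*-zeroʳ (minusTwo ^ suc k))
  powS-coefficient (suc m) zero = cong (1ℤ *_) (powS-coefficient m 0)
  powS-coefficient (suc m) (suc k) =
    begin
      sumTo (suc k) (λ i → oneMinus2x i * powS oneMinus2x m (suc k ∸ i))
    ≡⟨ sumTo-shift k (λ i → oneMinus2x i * powS oneMinus2x m (suc k ∸ i)) ⟩
      1ℤ * powS oneMinus2x m (suc k) + sumTo k (λ i → oneMinus2x (suc i) * powS oneMinus2x m (k ∸ i))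
    ≡⟨ cong₂ _+_ (cong (1ℤ *_) (powS-coefficient m (suc k))) (tail-sum k) ⟩
      1ℤ * (minusTwo ^ suc k * + binom m (suc k)) + minusTwo * powS oneMinus2x m k
    ≡⟨ cong (λ z → 1ℤ * (minusTwo ^ suc k * + binom m (suc k)) + minusTwo * z) (powS-coefficient m k) ⟩
      1ℤ * (minusTwo ^ suc k * + binom m (suc k)) + minusTwo * (minusTwo ^ k * + binom m k)
    ≡⟨ pascal (minusTwo ^ k) (+ binom m k) (+ binom m (suc k)) ⟩
      minusTwo ^ suc k * (+ binom m k + + binom m (suc k))
    ≡⟨ cong (minusTwo ^ suc k *_) (sym (pos-+ (binom m k) (binom m (suc k)))) ⟩
      minusTwo ^ suc k * + binom (suc m) (suc k)
    ∎
    where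
    open ≡-Reasoning
    open import Data.Integer.Tactic.RingSolver
    pascal : ∀ X a b → 1ℤ * ((minusTwo * X) * b) + minusTwo * (X * a) ≡ minusTwo * X * (a + b)
    pascal = solve-∀
    tail-sum : ∀ k → sumTo k (λ i → oneMinus2x (suc i) * powS oneMinus2x m (k ∸ i)) ≡ minusTwo * powS oneMinus2x m k
    tail-sum k = sumTo-trunc 0 k _ z≤n (λ { (suc zero) _ _ → refl ; (suc (suc i)) _ _ → refl })

  module GeneratingFunction (S : List ℕ) (top∈ : maxL S ∈ S) (ann : Annihilates (maxL S) (countℤ S) (maxL S)) where

    m : ℕ
    m = maxL S

    term : ℕ → ℕ → ℤ
    term n i = minusTwo ^ i * + binom m i * countℤ S (n ∸ i)

    statedTerm≡term : ∀ n j → minusTwo ^ j * + (m C j) * + countP S (n ∸ j) ≡ term n j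
    statedTerm≡term n j = cong₂ (λ a b → minusTwo ^ j * + a * + b) (sym (binom≡C m j)) (countP≡countPeaks S (n ∸ j))

    -- It vanishes when n - i ≤ m (no permutation of length ≤ m has a peak at m) …
    term-short : ∀ n i → n ∸ i ≤ m → term n i ≡ 0ℤ
    term-short n i short =
      trans (cong (minusTwo ^ i * + binom m i *_) (cong +_ (countPeaks-short S top∈ (n ∸ i) short)))
          (*-zeroʳ (minusTwo ^ i * + binom m i))

    term-beyond : ∀ n i → m < i → term n i ≡ 0ℤ
    term-beyond n i m<i =
      trans (cong (λ z → minusTwo ^ i * + z * countℤ S (n ∸ i)) (binom-zero m i m<i))
      (trans (cong (_* countℤ S (n ∸ i)) (*-zeroʳ (minusTwo ^ i))) (*-zeroˡ (countℤ S (n ∸ i))))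

    -- #P(S;0) = 0 as S is nonempty, so the series genP S has coefficients countℤ S.
    genP≡countℤ : ∀ t → genP S t ≡ countℤ S t
    genP≡countℤ zero = cong +_ (sym (countPeaks-short S top∈ 0 z≤n))
    genP≡countℤ (suc t) = cong +_ (countP≡countPeaks S (suc t))

    convolution : ∀ n → (powS oneMinus2x m ⋆ genP S) n ≡ sumTo n (term n)
    convolution n = sumTo-cong n (λ i _ → cong₂ _*_ (powS-coefficient m i) (genP≡countℤ (n ∸ i)))

    recurrence : ∀ n → 2 N.* m ≤ n → sumTo m (λ j → minusTwo ^ j * + (m C j) * + countP S (n ∸ j)) ≡ 0ℤ
    recurrence n 2m≤n = trans (sumTo-cong m (λ j _ → statedTerm≡term n j))
        (ann n (subst (_≤ n) (cong (m N.+_) (NP.+-identityʳ m)) 2m≤n))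

    coefficient-low : ∀ n → n ≤ m → sumTo n (term n) ≡ 0ℤ
    coefficient-low n n≤m = sumTo-zero n (term n) (λ i _ → term-short n i (NP.≤-trans (NP.m∸n≤m n i) n≤m))

    coefficient-middle : ∀ n → m < n
        → sumTo n (term n) ≡ sumTo (n ∸ m ∸ 1) (λ j → minusTwo ^ j * + (m C j) * + countP S (n ∸ j))
    coefficient-middle n m<n =
      trans (sumTo-trunc (n ∸ m ∸ 1) n (term n) (NP.≤-trans (NP.m∸n≤m (n ∸ m) 1) (NP.m∸n≤m n m)) vanish)
            (sym (sumTo-cong (n ∸ m ∸ 1) (λ j _ → statedTerm≡term n j)))
      where
      vanish : ∀ i → n ∸ m ∸ 1 < i → i ≤ n → term n i ≡ 0ℤ
      vanish i late _ = term-short n i (NP.≤-trans (NP.∸-monoʳ-≤ n n∸m≤i) (NP.≤-reflexive (NP.m∸[m∸n]≡n (NP.<⇒≤ m<n))))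
        where
        n∸m≤i : n ∸ m ≤ i
        n∸m≤i with n ∸ m
        ... | zero = z≤n
        ... | suc _ = late

    coefficient-high : ∀ n → 2 N.* m ≤ n → sumTo n (term n) ≡ 0ℤ
    coefficient-high n 2m≤n =
      trans (sumTo-trunc m n (term n) (NP.≤-trans (NP.m≤m+n m m) m+m≤n) (λ i m<i _ → term-beyond n i m<i)) (ann n m+m≤n)
      where
      m+m≤n : m N.+ m ≤ n
      m+m≤n = subst (_≤ n) (cong (m N.+_) (NP.+-identityʳ m)) 2m≤n

    coefficients : ∀ n → (powS oneMinus2x m ⋆ genP S) n ≡ rPoly S n
    coefficients n with suc m ≤ᵇ n in m<n? | n <ᵇ 2 N.* m in n<2m?
    ... | false | _ = trans (convolution n)
        (coefficient-low n (NP.≤-pred (NP.≰⇒> (λ m<n → false≢true (trans (sym m<n?) (≤ᵇ-true m<n))))))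
    ... | true | true = trans (convolution n) (coefficient-middle n (≤ᵇ-sound m<n?))
    ... | true | false = trans (convolution n) (coefficient-high n (NP.≮⇒≥ (<ᵇ-sound-false n (2 N.* m) n<2m?)))

open import Data.Nat using (ℕ; _∸_; _≤_; _*_)
import Data.Nat.Properties as NP
open import Data.Nat.Combinatorics using (_C_)
open import Data.Integer as ℤ using (ℤ)
open import Data.List using (List; []; _∷_)
open import Data.List.Relation.Unary.All using (All; _∷_)
open import Data.List.Relation.Unary.Any using (here)
open import Data.Product using (_×_; _,_)
open import Data.Empty using (⊥-elim)
open import Relation.Binary.PropositionalEquality using (_≡_; _≢_; refl; subst)
open Combinatorics using (maxL-ge; maxL-∈)
open Recurrence using (Annihilates; countℤ; order; peakCount-annihilated; module GeneratingFunction)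

-- For S nonempty of positive integers the order of annihilation max(S,1) is max S.
corollary2p4 : (S : List ℕ) → S ≢ [] → All (λ s → 1 ≤ s) S → Admissible S →
    ((n : ℕ) → (powS oneMinus2x (maxL S) ⋆ genP S) n ≡ rPoly S n)
    × ((n : ℕ) → 2 * maxL S ≤ n →
    sumTo (maxL S) (λ j → (ℤ.- (ℤ.+ 2)) ℤ.^ j ℤ.* ℤ.+ (maxL S C j) ℤ.* ℤ.+ countP S (n ∸ j)) ≡ ℤ.0ℤ)
corollary2p4 [] S≢[] _ _ = ⊥-elim (S≢[] refl)
corollary2p4 (y ∷ S') _ (1≤y ∷ _) _ = coefficients , recurrence
  where
  S = y ∷ S'
  order≡max : order S ≡ maxL S
  order≡max = NP.m≥n⇒m⊔n≡m (NP.≤-trans 1≤y (maxL-ge S (here refl)))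
  open GeneratingFunction S (maxL-∈ y S') (subst (λ k → Annihilates k (countℤ S) k) order≡max (peakCount-annihilated S))
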